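{- Let $0<\gamma<\tfrac12$, $0<\lambda<h(\gamma)$ (with $h$ the binary entropy function), and let $n$ be such that $i=\gamma n$ and $\lambda n$ are integers and $i$ is even. Let $L\subseteq\{0,1\}^n$ be the set of vectors of Hamming weight $i$, let $M$ be a uniformly random binary $\lambda n\times n$ matrix, $C=\{x: Mx=0\}$ over $\mathbb F_2$, $X=|L\cap C|$, $p=2^{ -\lambda n}$. Assume $k\le\lambda n-1$. Then \[ \frac12\sum_{S=(u_1,\dots,u_k)} p^{r(S)}\;\le\;\mathbb E_C\,(X-\mathbb E X)^k\;\le\;2\sum_{S=(u_1,\dots,u_k)} p^{r(S)}, \] where both sums range over all sequences $S=(u_1,\dots,u_k)\in L^k$ which contain no coloops, and $r(S)$ is the rank over $\mathbb F_2$ of the set $\{u_1,\dots,u_k\}$.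
   Context: A coloop of a sequence $(u_1,\dots,u_k)$ of vectors in $\mathbb F_2^n$ is an entry $u_j$ which is not contained in the $\mathbb F_2$-span of the remaining entries $u_l$, $l\ne j$. $\mathbb E_C$ denotes expectation over the random matrix $M$. -}

module Defs where

open import Data.Bool using (Bool; true; false; _∧_; _∨_; _xor_; not; if_then_else_)
open import Data.Nat as ℕ using (ℕ; zero; suc; _≡ᵇ_)
open import Data.Fin using (Fin; _≟_)
open import Data.List as List using (List; []; _∷_; concatMap; map; foldr; filter; length)
open import Data.Bool.ListAction using (and; or)
open import Data.Vec as Vec using (Vec; []; _∷_; zipWith; replicate; lookup; allFin; toList)
open import Data.Integer using (+_)
open import Data.Rational using (ℚ; 0ℚ; 1ℚ; _+_; _*_; _-_; _/_)
open import Relation.Nullary.Decidable using (⌊_⌋)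

-- Vectors of F₂ⁿ are encoded as Vec Bool n (true = 1, xor = addition).

F2^ : ℕ → Set
F2^ n = Vec Bool n

allSeqs : {A : Set} → List A → (k : ℕ) → List (Vec A k)
allSeqs xs zero    = [] ∷ []
allSeqs xs (suc k) = concatMap (λ x → map (x ∷_) (allSeqs xs k)) xs

allVecs : (n : ℕ) → List (F2^ n)
allVecs n = allSeqs (false ∷ true ∷ []) n

zeroV : ∀ {n} → F2^ n
zeroV = replicate _ false

addV : ∀ {n} → F2^ n → F2^ n → F2^ n
addV = zipWith _xor_

scaleV : ∀ {n} → Bool → F2^ n → F2^ n
scaleV c v = Vec.map (c ∧_) v

eqV : ∀ {n} → F2^ n → F2^ n → Bool
eqV []       []       = true
eqV (a ∷ u) (b ∷ v) = not (a xor b) ∧ eqV u v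

weight : ∀ {n} → F2^ n → ℕ
weight []          = 0
weight (true ∷ v)  = suc (weight v)
weight (false ∷ v) = weight v

linComb : ∀ {n k} → Vec Bool k → Vec (F2^ n) k → F2^ n
linComb []       []       = zeroV
linComb (c ∷ cs) (u ∷ us) = addV (scaleV c u) (linComb cs us)

inSpanOfOthers : ∀ {n k} → Vec (F2^ n) k → Fin k → Bool
inSpanOfOthers {k = k} us j =
  or (map (λ c → not (lookup c j) ∧ eqV (linComb c us) (lookup us j)) (allVecs k))

isColoop : ∀ {n k} → Vec (F2^ n) k → Fin k → Bool
isColoop us j = not (inSpanOfOthers us j)

noColoops : ∀ {n k} → Vec (F2^ n) k → Bool
noColoops us = not (or (map (isColoop us) (toList (allFin _))))

card : ∀ {k} → Vec Bool k → ℕ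
card = weight

independentSub : ∀ {n k} → Vec (F2^ n) k → Vec Bool k → Bool
independentSub {k = k} us c =
  and (map (λ d → not (and (toList (zipWith (λ di ci → not di ∨ ci) d c)))
                  ∨ not (eqV (linComb d us) zeroV)
                  ∨ eqV d zeroV)
           (allVecs k))

rank : ∀ {n k} → Vec (F2^ n) k → ℕ
rank {k = k} us =
  foldr ℕ._⊔_ 0 (map (λ c → if independentSub us c then card c else 0) (allVecs k))

Matrix : ℕ → ℕ → Set
Matrix m n = Vec (F2^ n) m

allMatrices : (m n : ℕ) → List (Matrix m n)
allMatrices m n = allSeqs (allVecs n) m

dot : ∀ {n} → F2^ n → F2^ n → Bool
dot u v = Vec.foldr _ _xor_ false (zipWith _∧_ u v)

inKernel : ∀ {m n} → Matrix m n → F2^ n → Bool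
inKernel M x = Vec.foldr _ _∧_ true (Vec.map (λ row → not (dot row x)) M)

Lset : (n i : ℕ) → List (F2^ n)
Lset n i = filter (λ v → weight v ℕ.≟ i) (allVecs n)

Xval : ∀ {m n} → (i : ℕ) → Matrix m n → ℕ
Xval {n = n} i M = length (filter (λ x → inKernel M x Data.Bool.≟ true) (Lset n i))

sumℚ : List ℚ → ℚ
sumℚ = foldr _+_ 0ℚ

powℚ : ℚ → ℕ → ℚ
powℚ q zero    = 1ℚ
powℚ q (suc k) = q * powℚ q k

½ : ℚ
½ = + 1 / 2

toℚ : ℕ → ℚ
toℚ k = + k / 1

expect : (m n : ℕ) → (Matrix m n → ℚ) → ℚ
expect m n f = powℚ ½ (m ℕ.* n) * sumℚ (map f (allMatrices m n))

meanX : (m n i : ℕ) → ℚ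
meanX m n i = expect m n (λ M → toℚ (Xval i M))

centralMoment : (m n i k : ℕ) → ℚ
centralMoment m n i k = expect m n (λ M → powℚ (toℚ (Xval i M) - meanX m n i) k)

pval : ℕ → ℚ
pval m = powℚ ½ m

coloopFreeSum : (m n i k : ℕ) → ℚ
coloopFreeSum m n i k =
  sumℚ (map (λ S → if noColoops S then powℚ (pval m) (rank S) else 0ℚ)
            (allSeqs (Lset n i) k))

-- λ < h(γ) with γ = i/n, λ = m/n, h the binary entropy function:
--   m/n < -(i/n) log₂(i/n) - (1 - i/n) log₂(1 - i/n)
--   ⇔ m < log₂ ( nⁿ / (iⁱ (n-i)^{n-i}) )
--   ⇔ 2^m · iⁱ · (n-i)^{n-i} < nⁿ     (exact, for 0 < i < n)
belowEntropy : (m n i : ℕ) → Set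
belowEntropy m n i = 2 ℕ.^ m ℕ.* (i ℕ.^ i) ℕ.* ((n ℕ.∸ i) ℕ.^ (n ℕ.∸ i)) ℕ.< n ℕ.^ n

module Submission where

-- Write X − 𝔼X = Σ_{u ∈ L} (1[Mu = 0] − p) and expand the k-th power over sequences S ∈ Lᵏ,
-- so that 𝔼 (X − 𝔼X)ᵏ = Σ_S 𝔼 Πⱼ (1[Muⱼ = 0] − p). Expanding that product over the sets c of
-- indices j whose factor 1[Muⱼ = 0] is kept, and using that the m rows of M are independent
-- and uniform, 𝔼 Π_{j ∈ c} 1[Muⱼ = 0] = (|c^⊥| / 2ⁿ)ᵐ = p^{rank c}, where c^⊥ is the set of
-- vectors orthogonal to all selected uⱼ. If uⱼ is a coloop, adding j to a set c not containing
-- it halves c^⊥, so the terms for c and c ∪ {j} cancel and S contributes nothing. If S has no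
-- coloops, the full set of indices contributes p^{r(S)}; dropping one index does not lower the
-- rank and dropping each further index lowers it by at most one, so each of the other 2ᵏ − 1
-- terms is at most p · p^{r(S)} in absolute value. As 2ᵏ p ≤ ½ for k < m, the contribution of
-- S lies between ½ p^{r(S)} and 2 p^{r(S)}.

open import Defs

module LinearAlgebra where

  open import Algebra.Bundles using (CommutativeRing)
  open import Data.Bool as Bool using (Bool; true; false; _∧_; _∨_; _xor_; not; b≤b)
  open import Data.Bool.Properties
  open import Data.Product using (∃-syntax; _×_; _,_)
  open import Data.Sum as Sum using (_⊎_; inj₁; inj₂)
  open import Data.Vec using (Vec; []; _∷_)
  open import Data.Vec.Properties using (zipWith-identityˡ; zipWith-identityʳ; zipWith-comm; zipWith-assoc; map-const; map-id)
  open import Data.Vec.Relation.Binary.Pointwise.Inductive using (Pointwise; []; _∷_)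
  open import Function using (id)
  open import Relation.Binary.PropositionalEquality
  open import Algebra.Properties.CommutativeSemigroup
    (CommutativeRing.+-commutativeSemigroup xor-∧-commutativeRing) using (interchange)
  open ≡-Reasoning

  addV-identityˡ : ∀ {n} (v : F2^ n) → addV zeroV v ≡ v
  addV-identityˡ = zipWith-identityˡ xor-identityˡ

  addV-identityʳ : ∀ {n} (v : F2^ n) → addV v zeroV ≡ v
  addV-identityʳ = zipWith-identityʳ xor-identityʳ

  addV-comm : ∀ {n} (u v : F2^ n) → addV u v ≡ addV v u
  addV-comm = zipWith-comm xor-comm

  addV-assoc : ∀ {n} (u v w : F2^ n) → addV (addV u v) w ≡ addV u (addV v w)
  addV-assoc = zipWith-assoc xor-assoc

  addV-self : ∀ {n} (v : F2^ n) → addV v v ≡ zeroV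
  addV-self []      = refl
  addV-self (x ∷ v) = cong₂ _∷_ (xor-same x) (addV-self v)

  addV-cancelʳ : ∀ {n} (u v : F2^ n) → addV (addV u v) v ≡ u
  addV-cancelʳ u v = begin
    addV (addV u v) v ≡⟨ addV-assoc u v v ⟩
    addV u (addV v v) ≡⟨ cong (addV u) (addV-self v) ⟩
    addV u zeroV      ≡⟨ addV-identityʳ u ⟩
    u                 ∎

  scaleV-false : ∀ {n} (v : F2^ n) → scaleV false v ≡ zeroV
  scaleV-false v = map-const v false

  scaleV-true : ∀ {n} (v : F2^ n) → scaleV true v ≡ v
  scaleV-true = map-id

  dot-zeroˡ : ∀ {n} (u : F2^ n) → dot zeroV u ≡ false
  dot-zeroˡ []      = refl
  dot-zeroˡ (_ ∷ u) = dot-zeroˡ u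

  dot-zeroʳ : ∀ {n} (r : F2^ n) → dot r zeroV ≡ false
  dot-zeroʳ []      = refl
  dot-zeroʳ (a ∷ r) = cong₂ _xor_ (∧-zeroʳ a) (dot-zeroʳ r)

  dot-distribˡ-addV : ∀ {n} (r u v : F2^ n) → dot r (addV u v) ≡ dot r u xor dot r v
  dot-distribˡ-addV []      []      []      = refl
  dot-distribˡ-addV (a ∷ r) (b ∷ u) (c ∷ v) = trans
    (cong₂ _xor_ (∧-distribˡ-xor a b c) (dot-distribˡ-addV r u v))
    (interchange (a ∧ b) (a ∧ c) (dot r u) (dot r v))

  dot-distribʳ-addV : ∀ {n} (r w u : F2^ n) → dot (addV r w) u ≡ dot r u xor dot w u
  dot-distribʳ-addV []      []      []      = refl
  dot-distribʳ-addV (a ∷ r) (b ∷ w) (c ∷ u) = trans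
    (cong₂ _xor_ (∧-distribʳ-xor c a b) (dot-distribʳ-addV r w u))
    (interchange (a ∧ c) (b ∧ c) (dot r u) (dot w u))

  zeroV-or-detected : ∀ {n} (u : F2^ n) → u ≡ zeroV ⊎ ∃[ w ] dot w u ≡ true
  zeroV-or-detected []          = inj₁ refl
  zeroV-or-detected (true ∷ u)  = inj₂ (true ∷ zeroV , cong (true xor_) (dot-zeroˡ u))
  zeroV-or-detected (false ∷ u) with zeroV-or-detected u
  ... | inj₁ u≡0        = inj₁ (cong (false ∷_) u≡0)
  ... | inj₂ (w , w·u) = inj₂ (false ∷ w , w·u)

  linComb-false∷ : ∀ {n k} (t : F2^ n) (d : Vec Bool k) (us : Vec (F2^ n) k) →
                   linComb (false ∷ d) (t ∷ us) ≡ linComb d us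
  linComb-false∷ t d us =
    trans (cong (λ x → addV x (linComb d us)) (scaleV-false t)) (addV-identityˡ _)

  linComb-true∷ : ∀ {n k} (t : F2^ n) (d : Vec Bool k) (us : Vec (F2^ n) k) →
                  linComb (true ∷ d) (t ∷ us) ≡ addV t (linComb d us)
  linComb-true∷ t d us = cong (λ x → addV x (linComb d us)) (scaleV-true t)

  _⊆_ : ∀ {k} → Vec Bool k → Vec Bool k → Set
  _⊆_ = Pointwise Bool._≤_

  orthogonal : ∀ {n k} → Vec (F2^ n) k → Vec Bool k → F2^ n → Bool
  orthogonal []       []      r = true
  orthogonal (u ∷ us) (b ∷ c) r = (not b ∨ not (dot r u)) ∧ orthogonal us c r

  InSpan : ∀ {n k} → Vec (F2^ n) k → Vec Bool k → F2^ n → Set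
  InSpan us c u = ∃[ d ] d ⊆ c × linComb d us ≡ u

  Separated : ∀ {n k} → Vec (F2^ n) k → Vec Bool k → F2^ n → Set
  Separated us c u = ∃[ r ] orthogonal us c r ≡ true × dot r u ≡ true

  orthogonal-linComb : ∀ {n k} (us : Vec (F2^ n) k) {c d : Vec Bool k} (r : F2^ n) →
                       d ⊆ c → orthogonal us c r ≡ true → dot r (linComb d us) ≡ false
  orthogonal-linComb []       r [] _ = dot-zeroʳ r
  orthogonal-linComb (u ∷ us) {d = false ∷ d} r (_ ∷ d⊆c) ⊥r =
    trans (cong (dot r) (linComb-false∷ u d us))
          (orthogonal-linComb us r d⊆c (∧-conicalʳ _ _ ⊥r))
  orthogonal-linComb (u ∷ us) {d = true ∷ d} r (b≤b ∷ d⊆c) ⊥r = begin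
    dot r (linComb (true ∷ d) (u ∷ us)) ≡⟨ cong (dot r) (linComb-true∷ u d us) ⟩
    dot r (addV u (linComb d us))       ≡⟨ dot-distribˡ-addV r u _ ⟩
    dot r u xor dot r (linComb d us)
      ≡⟨ cong₂ _xor_ (not-injective (∧-conicalˡ (not (dot r u)) _ ⊥r))
                     (orthogonal-linComb us r d⊆c (∧-conicalʳ _ _ ⊥r)) ⟩
    false                               ∎

  orthogonal-true∷ : ∀ {n k} (us : Vec (F2^ n) k) (c : Vec Bool k) (t r : F2^ n) →
                     dot r t ≡ false → orthogonal us c r ≡ true →
                     orthogonal (t ∷ us) (true ∷ c) r ≡ true
  orthogonal-true∷ _ _ _ _ = cong₂ (λ x y → not x ∧ y)

  orthogonal-addV : ∀ {n k} (us : Vec (F2^ n) k) (c : Vec Bool k) (r w : F2^ n) →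
                    orthogonal us c w ≡ true → orthogonal us c (addV r w) ≡ orthogonal us c r
  orthogonal-addV []       []          r w _  = refl
  orthogonal-addV (u ∷ us) (false ∷ c) r w ⊥w = orthogonal-addV us c r w ⊥w
  orthogonal-addV (u ∷ us) (true ∷ c)  r w ⊥w = cong₂ (λ x y → not x ∧ y)
    (begin
      dot (addV r w) u    ≡⟨ dot-distribʳ-addV r w u ⟩
      dot r u xor dot w u ≡⟨ cong (dot r u xor_) (not-injective (∧-conicalˡ (not (dot w u)) _ ⊥w)) ⟩
      dot r u xor false   ≡⟨ xor-identityʳ _ ⟩
      dot r u             ∎)
    (orthogonal-addV us c r w (∧-conicalʳ _ _ ⊥w))

  inSpan-∷ : ∀ {n k} {us : Vec (F2^ n) k} {c : Vec Bool k} {u : F2^ n} (t : F2^ n) {b : Bool} →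
             InSpan us c u → InSpan (t ∷ us) (b ∷ c) u
  inSpan-∷ {us = us} t {b} (d , d⊆c , d·us≡u) =
    false ∷ d , ≤-minimum b ∷ d⊆c , trans (linComb-false∷ t d us) d·us≡u

  inSpan-true∷ : ∀ {n k} {us : Vec (F2^ n) k} {c : Vec Bool k} {u t : F2^ n} →
                 InSpan us c (addV u t) → InSpan (t ∷ us) (true ∷ c) u
  inSpan-true∷ {us = us} {u = u} {t} (d , d⊆c , d·us≡u+t) = true ∷ d , b≤b ∷ d⊆c , (begin
    linComb (true ∷ d) (t ∷ us) ≡⟨ linComb-true∷ t d us ⟩
    addV t (linComb d us)       ≡⟨ cong (addV t) d·us≡u+t ⟩
    addV t (addV u t)           ≡⟨ addV-comm t (addV u t) ⟩
    addV (addV u t) t           ≡⟨ addV-cancelʳ u t ⟩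
    u                           ∎)

  dot-flip : ∀ {n} (w u t : F2^ n) → dot w (addV u t) ≡ true → dot w u ≡ not (dot w t)
  dot-flip w u t w·[u+t] = begin
    dot w u                      ≡⟨ cong (dot w) (addV-cancelʳ u t) ⟨
    dot w (addV (addV u t) t)    ≡⟨ dot-distribˡ-addV w (addV u t) t ⟩
    dot w (addV u t) xor dot w t ≡⟨ cong (_xor dot w t) w·[u+t] ⟩
    not (dot w t)                ∎

  -- If neither w₁ nor w₂ is orthogonal to t, then w₁ + w₂ is, and it still detects u.
  separated-true∷ : ∀ {n k} {us : Vec (F2^ n) k} {c : Vec Bool k} {u t : F2^ n} →
                    Separated us c u → Separated us c (addV u t) →
                    Separated (t ∷ us) (true ∷ c) u
  separated-true∷ {us = us} {c} {u} {t} (w₁ , ⊥w₁ , w₁·u) (w₂ , ⊥w₂ , w₂·[u+t])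
    with dot w₁ t in w₁·t | dot w₂ t in w₂·t
  ... | false | _     = w₁ , orthogonal-true∷ us c t w₁ w₁·t ⊥w₁ , w₁·u
  ... | true  | false = w₂ , orthogonal-true∷ us c t w₂ w₂·t ⊥w₂ , trans (dot-flip w₂ u t w₂·[u+t]) (cong not w₂·t)
  ... | true  | true  = addV w₁ w₂ , orthogonal-true∷ us c t (addV w₁ w₂) w·t ⊥w , w·u
    where
    ⊥w : orthogonal us c (addV w₁ w₂) ≡ true
    ⊥w = trans (orthogonal-addV us c w₁ w₂ ⊥w₂) ⊥w₁
    w·t : dot (addV w₁ w₂) t ≡ false
    w·t = trans (dot-distribʳ-addV w₁ w₂ t) (cong₂ _xor_ w₁·t w₂·t)
    w·u : dot (addV w₁ w₂) u ≡ true
    w·u = trans (dot-distribʳ-addV w₁ w₂ u) (cong₂ _xor_ w₁·u (trans (dot-flip w₂ u t w₂·[u+t]) (cong not w₂·t)))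

  inSpan⊎separated : ∀ {n k} (us : Vec (F2^ n) k) (c : Vec Bool k) (u : F2^ n) →
                     InSpan us c u ⊎ Separated us c u
  inSpan⊎separated [] [] u =
    Sum.map (λ u≡0 → [] , [] , sym u≡0) (λ (w , w·u) → w , refl , w·u) (zeroV-or-detected u)
  inSpan⊎separated (t ∷ us) (false ∷ c) u = Sum.map (inSpan-∷ t) id (inSpan⊎separated us c u)
  inSpan⊎separated (t ∷ us) (true ∷ c) u
    with inSpan⊎separated us c u | inSpan⊎separated us c (addV u t)
  ... | inj₁ u∈ | _            = inj₁ (inSpan-∷ t u∈)
  ... | inj₂ _  | inj₁ u+t∈    = inj₁ (inSpan-true∷ u+t∈)
  ... | inj₂ u∉ | inj₂ u+t∉    = inj₂ (separated-true∷ {us = us} {c} u∉ u+t∉)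

module Annihilators where

  open LinearAlgebra
  open import Data.Bool as Bool using (Bool; true; false; _∧_; _∨_; _xor_; not; if_then_else_; f≤t; b≤b)
  open import Data.Bool.Properties
    using (∧-comm; ∧-assoc; ∧-identityʳ; ∧-conicalˡ; ∧-conicalʳ; ∨-zeroʳ; xor-comm; not-injective; ≤-minimum; ≤-maximum)
  import Data.Bool.Properties as Boolₚ
  open import Data.Bool.ListAction using (and; or)
  open import Data.Fin using (Fin; zero; suc)
  open import Data.List using (List; []; _∷_; _++_; map; foldr)
  open import Data.List.Properties using (map-++; map-∘; map-cong; ++-identityʳ)
  open import Data.List.Membership.Propositional using (_∈_)
  open import Data.List.Membership.Propositional.Properties using (∈-map⁺; ∈-concatMap⁺)
  open import Data.List.Relation.Unary.Any using (here; there)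
  open import Data.Nat using (ℕ; zero; suc; _+_; _*_; _^_; _≤_; _<_; _⊔_; z≤n; s≤s; NonZero; ≢-nonZero)
  open import Data.Nat.Properties
  open import Data.Nat.ListAction using (sum)
  open import Data.Nat.ListAction.Properties using (sum-++)
  open import Data.Product using (∃-syntax; _×_; _,_)
  open import Data.Sum using (_⊎_; inj₁; inj₂)
  open import Data.Vec as Vec using (Vec; []; _∷_; lookup; replicate; toList; zipWith; allFin; _[_]≔_)
  open import Data.Vec.Properties using ([]≔-idempotent; []≔-lookup; lookup-replicate; lookup∘update)
  open import Data.Vec.Membership.Propositional.Properties using (∈-toList⁺; ∈-allFin⁺)
  open import Data.Vec.Relation.Binary.Pointwise.Inductive as Pointwise using ([]; _∷_)
  open import Function using (_∘_)
  open import Relation.Binary.PropositionalEquality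
  open import Relation.Nullary using (contradiction)
  open import Algebra.Properties.CommutativeSemigroup *-commutativeSemigroup using (x∙yz≈y∙xz)

  allVecs-suc : ∀ n → allVecs (suc n) ≡ map (false ∷_) (allVecs n) ++ map (true ∷_) (allVecs n)
  allVecs-suc n = cong (map (false ∷_) (allVecs n) ++_) (++-identityʳ _)

  map-allVecs-suc : ∀ {B : Set} {n} (f : F2^ (suc n) → B) →
                    map f (allVecs (suc n)) ≡
                    map (f ∘ (false ∷_)) (allVecs n) ++ map (f ∘ (true ∷_)) (allVecs n)
  map-allVecs-suc {n = n} f = begin
    map f (allVecs (suc n))
      ≡⟨ cong (map f) (allVecs-suc n) ⟩
    map f (map (false ∷_) (allVecs n) ++ map (true ∷_) (allVecs n))
      ≡⟨ map-++ f (map (false ∷_) (allVecs n)) _ ⟩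
    map f (map (false ∷_) (allVecs n)) ++ map f (map (true ∷_) (allVecs n))
      ≡⟨ cong₂ _++_ (map-∘ (allVecs n)) (map-∘ (allVecs n)) ⟨
    map (f ∘ (false ∷_)) (allVecs n) ++ map (f ∘ (true ∷_)) (allVecs n) ∎
    where open ≡-Reasoning

  count : ∀ {A : Set} → (A → Bool) → List A → ℕ
  count P xs = sum (map (λ x → if P x then 1 else 0) xs)

  count-cong : ∀ {A : Set} {P Q : A → Bool} (xs : List A) → (∀ x → P x ≡ Q x) →
               count P xs ≡ count Q xs
  count-cong xs P≗Q = cong sum (map-cong (λ x → cong (if_then 1 else 0) (P≗Q x)) xs)

  count-allVecs-suc : ∀ {n} (P : F2^ (suc n) → Bool) →
                      count P (allVecs (suc n)) ≡
                      count (P ∘ (false ∷_)) (allVecs n) + count (P ∘ (true ∷_)) (allVecs n)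
  count-allVecs-suc {n} P =
    trans (cong sum (map-allVecs-suc (λ x → if P x then 1 else 0)))
          (sum-++ (map (λ x → if P (false ∷ x) then 1 else 0) (allVecs n)) _)

  count-true-allVecs : ∀ n → count (λ _ → true) (allVecs n) ≡ 2 ^ n
  count-true-allVecs zero    = refl
  count-true-allVecs (suc n) = begin
    count (λ _ → true) (allVecs (suc n))   ≡⟨ count-allVecs-suc {n} (λ _ → true) ⟩
    count (λ _ → true) (allVecs n) + count (λ _ → true) (allVecs n)
      ≡⟨ cong₂ _+_ (count-true-allVecs n) (count-true-allVecs n) ⟩
    2 ^ n + 2 ^ n                          ≡⟨ cong (2 ^ n +_) (+-identityʳ (2 ^ n)) ⟨
    2 ^ n + (2 ^ n + 0)                    ∎
    where open ≡-Reasoning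

  count-split : ∀ {A : Set} (P D : A → Bool) (xs : List A) →
                count P xs ≡ count (λ x → P x ∧ not (D x)) xs + count (λ x → P x ∧ D x) xs
  count-split P D []       = refl
  count-split P D (x ∷ xs) with P x | D x
  ... | false | _     = count-split P D xs
  ... | true  | false = cong suc (count-split P D xs)
  ... | true  | true  = trans (cong suc (count-split P D xs)) (sym (+-suc _ _))

  count-mono : ∀ {A : Set} {P Q : A → Bool} (xs : List A) →
               (∀ x → P x ≡ true → Q x ≡ true) → count P xs ≤ count Q xs
  count-mono []       P⇒Q = z≤n
  count-mono {P = P} {Q} (x ∷ xs) P⇒Q with P x in Px | Q x in Qx
  ... | false | false = count-mono xs P⇒Q
  ... | false | true  = m≤n⇒m≤1+n (count-mono xs P⇒Q)
  ... | true  | false = contradiction (trans (sym Qx) (P⇒Q x Px)) λ ()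
  ... | true  | true  = s≤s (count-mono xs P⇒Q)

  count-translate : ∀ n (P : F2^ n → Bool) (w : F2^ n) →
                    count (λ r → P (addV r w)) (allVecs n) ≡ count P (allVecs n)
  count-translate zero    P []      = refl
  count-translate (suc n) P (b ∷ w) = begin
    count (λ r → P (addV r (b ∷ w))) (allVecs (suc n))
      ≡⟨ count-allVecs-suc (λ r → P (addV r (b ∷ w))) ⟩
    count (λ r → P (b ∷ addV r w)) (allVecs n) + count (λ r → P (not b ∷ addV r w)) (allVecs n)
      ≡⟨ cong₂ _+_ (count-translate n (P ∘ (b ∷_)) w) (count-translate n (P ∘ (not b ∷_)) w) ⟩
    count (P ∘ (b ∷_)) (allVecs n) + count (P ∘ (not b ∷_)) (allVecs n)
      ≡⟨ halves b ⟩
    count (P ∘ (false ∷_)) (allVecs n) + count (P ∘ (true ∷_)) (allVecs n)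
      ≡⟨ count-allVecs-suc P ⟨
    count P (allVecs (suc n)) ∎
    where
    open ≡-Reasoning
    halves : ∀ b → count (P ∘ (b ∷_)) (allVecs n) + count (P ∘ (not b ∷_)) (allVecs n) ≡
                   count (P ∘ (false ∷_)) (allVecs n) + count (P ∘ (true ∷_)) (allVecs n)
    halves false = refl
    halves true  = +-comm (count (P ∘ (true ∷_)) (allVecs n)) _

  -- Translation by a separating vector exchanges the two halves of the annihilator.
  count-separated : ∀ {n k} (us : Vec (F2^ n) k) (c : Vec Bool k) (u : F2^ n) → Separated us c u →
                    count (orthogonal us c) (allVecs n) ≡
                    2 * count (λ r → orthogonal us c r ∧ not (dot r u)) (allVecs n)
  count-separated {n} us c u (w , ⊥w , w·u) = begin
    count (orthogonal us c) (allVecs n)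
      ≡⟨ count-split (orthogonal us c) (λ r → dot r u) (allVecs n) ⟩
    count undetected (allVecs n) + count (λ r → orthogonal us c r ∧ dot r u) (allVecs n)
      ≡⟨ cong (count undetected (allVecs n) +_) (count-translate n _ w) ⟨
    count undetected (allVecs n) + count (λ r → orthogonal us c (addV r w) ∧ dot (addV r w) u) (allVecs n)
      ≡⟨ cong (count undetected (allVecs n) +_) (count-cong (allVecs n) shift) ⟩
    count undetected (allVecs n) + count undetected (allVecs n)
      ≡⟨ cong (count undetected (allVecs n) +_) (+-identityʳ _) ⟨
    2 * count undetected (allVecs n) ∎
    where
    open ≡-Reasoning
    undetected : F2^ n → Bool
    undetected r = orthogonal us c r ∧ not (dot r u)
    shift : ∀ r → orthogonal us c (addV r w) ∧ dot (addV r w) u ≡ undetected r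
    shift r = cong₂ _∧_ (orthogonal-addV us c r w ⊥w) (begin
      dot (addV r w) u    ≡⟨ dot-distribʳ-addV r w u ⟩
      dot r u xor dot w u ≡⟨ cong (dot r u xor_) w·u ⟩
      dot r u xor true    ≡⟨ xor-comm (dot r u) true ⟩
      not (dot r u)       ∎)
      where open ≡-Reasoning

  orthogonal-[]≔true : ∀ {n k} (us : Vec (F2^ n) k) (c : Vec Bool k) (j : Fin k) (r : F2^ n) →
                       orthogonal us (c [ j ]≔ true) r ≡ orthogonal us c r ∧ not (dot r (lookup us j))
  orthogonal-[]≔true (u ∷ us) (false ∷ c) zero r = ∧-comm (not (dot r u)) _
  orthogonal-[]≔true (u ∷ us) (true ∷ c) zero r with dot r u
  ... | true  = refl
  ... | false = sym (∧-identityʳ _)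
  orthogonal-[]≔true (u ∷ us) (x ∷ c) (suc j) r =
    trans (cong ((not x ∨ not (dot r u)) ∧_) (orthogonal-[]≔true us c j r)) (sym (∧-assoc (not x ∨ not (dot r u)) _ _))

  orthogonal-antitone : ∀ {n k} (us : Vec (F2^ n) k) {c e : Vec Bool k} (r : F2^ n) →
                        c ⊆ e → orthogonal us e r ≡ true → orthogonal us c r ≡ true
  orthogonal-antitone []       r []            _  = refl
  orthogonal-antitone (u ∷ us) r (f≤t ∷ c⊆e)  ⊥r = orthogonal-antitone us r c⊆e (∧-conicalʳ _ _ ⊥r)
  orthogonal-antitone (u ∷ us) {false ∷ _} r (b≤b ∷ c⊆e) ⊥r = orthogonal-antitone us r c⊆e ⊥r
  orthogonal-antitone (u ∷ us) {true ∷ _}  r (b≤b ∷ c⊆e) ⊥r =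
    cong₂ _∧_ (∧-conicalˡ _ _ ⊥r) (orthogonal-antitone us r c⊆e (∧-conicalʳ _ _ ⊥r))

  orthogonal-inSpan : ∀ {n k} (us : Vec (F2^ n) k) (c : Vec Bool k) {u : F2^ n} → InSpan us c u →
                      ∀ r → orthogonal us c r ∧ not (dot r u) ≡ orthogonal us c r
  orthogonal-inSpan us c (d , d⊆c , d·us≡u) r with orthogonal us c r in ⊥r
  ... | false = refl
  ... | true  = cong not (trans (cong (dot r) (sym d·us≡u)) (orthogonal-linComb us r d⊆c ⊥r))

  annihilatorSize : ∀ {n k} → Vec (F2^ n) k → Vec Bool k → ℕ
  annihilatorSize {n} us c = count (orthogonal us c) (allVecs n)

  annihilatorSize-separated : ∀ {n k} (us : Vec (F2^ n) k) (c : Vec Bool k) (j : Fin k) →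
                              Separated us c (lookup us j) →
                              annihilatorSize us c ≡ 2 * annihilatorSize us (c [ j ]≔ true)
  annihilatorSize-separated {n} us c j sep = trans (count-separated us c (lookup us j) sep)
    (cong (2 *_) (count-cong (allVecs n) (λ r → sym (orthogonal-[]≔true us c j r))))

  annihilatorSize-inSpan : ∀ {n k} (us : Vec (F2^ n) k) (c : Vec Bool k) (j : Fin k) →
                           InSpan us c (lookup us j) →
                           annihilatorSize us (c [ j ]≔ true) ≡ annihilatorSize us c
  annihilatorSize-inSpan {n} us c j uⱼ∈ = count-cong (allVecs n)
    (λ r → trans (orthogonal-[]≔true us c j r) (orthogonal-inSpan us c uⱼ∈ r))

  annihilatorSize-antitone : ∀ {n k} (us : Vec (F2^ n) k) {c e : Vec Bool k} →
                             c ⊆ e → annihilatorSize us e ≤ annihilatorSize us c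
  annihilatorSize-antitone {n} us c⊆e = count-mono (allVecs n) (λ r → orthogonal-antitone us r c⊆e)

  full : ∀ k → Vec Bool k
  full k = replicate k true

  empty : ∀ k → Vec Bool k
  empty k = replicate k false

  ⊆-trans : ∀ {k} {a b c : Vec Bool k} → a ⊆ b → b ⊆ c → a ⊆ c
  ⊆-trans = Pointwise.trans Boolₚ.≤-trans

  ⊆-full : ∀ {k} (c : Vec Bool k) → c ⊆ full k
  ⊆-full []      = []
  ⊆-full (b ∷ c) = ≤-maximum b ∷ ⊆-full c

  inSpan-mono : ∀ {n k} {us : Vec (F2^ n) k} {c e : Vec Bool k} {u : F2^ n} →
                c ⊆ e → InSpan us c u → InSpan us e u
  inSpan-mono c⊆e (d , d⊆c , d·us≡u) = d , ⊆-trans d⊆c c⊆e , d·us≡u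

  -- Φ us c = 2ⁿ · 2^(|c| − dim span{uⱼ : j ∈ c}).
  Φ : ∀ {n k} → Vec (F2^ n) k → Vec Bool k → ℕ
  Φ us c = annihilatorSize us c * 2 ^ weight c

  Φ-[] : ∀ n → Φ {n} [] [] ≡ 2 ^ n
  Φ-[] n = trans (*-identityʳ _) (count-true-allVecs n)

  Φ-true∷-separated : ∀ {n k} (us : Vec (F2^ n) k) (c : Vec Bool k) (u : F2^ n) →
                      Separated us c u → Φ (u ∷ us) (true ∷ c) ≡ Φ us c
  Φ-true∷-separated us c u sep = begin
    z * (2 * 2 ^ weight c) ≡⟨ x∙yz≈y∙xz z 2 (2 ^ weight c) ⟩
    2 * (z * 2 ^ weight c) ≡⟨ *-assoc 2 z _ ⟨
    2 * z * 2 ^ weight c   ≡⟨ cong (_* 2 ^ weight c) (annihilatorSize-separated (u ∷ us) (false ∷ c) zero sep) ⟨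
    Φ us c                 ∎
    where
    open ≡-Reasoning
    z = annihilatorSize (u ∷ us) (true ∷ c)

  Φ-true∷-inSpan : ∀ {n k} (us : Vec (F2^ n) k) (c : Vec Bool k) (u : F2^ n) →
                   InSpan us c u → Φ (u ∷ us) (true ∷ c) ≡ 2 * Φ us c
  Φ-true∷-inSpan us c u u∈ = begin
    annihilatorSize (u ∷ us) (true ∷ c) * (2 * 2 ^ weight c)
      ≡⟨ cong (_* (2 * 2 ^ weight c)) (annihilatorSize-inSpan (u ∷ us) (false ∷ c) zero (inSpan-∷ u u∈)) ⟩
    annihilatorSize us c * (2 * 2 ^ weight c)
      ≡⟨ x∙yz≈y∙xz (annihilatorSize us c) 2 (2 ^ weight c) ⟩
    2 * Φ us c ∎
    where open ≡-Reasoning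

  Φ-true∷-≥ : ∀ {n k} (us : Vec (F2^ n) k) (c : Vec Bool k) (u : F2^ n) →
              Φ us c ≤ Φ (u ∷ us) (true ∷ c)
  Φ-true∷-≥ us c u with inSpan⊎separated us c u
  ... | inj₁ u∈ = ≤-trans (m≤m+n (Φ us c) _) (≤-reflexive (sym (Φ-true∷-inSpan us c u u∈)))
  ... | inj₂ u∉ = ≤-reflexive (sym (Φ-true∷-separated us c u u∉))

  Φ-monotone : ∀ {n k} (us : Vec (F2^ n) k) {c e : Vec Bool k} → c ⊆ e → Φ us c ≤ Φ us e
  Φ-monotone []       [] = ≤-refl
  Φ-monotone (u ∷ us) {_ ∷ c} {_ ∷ e} (f≤t ∷ c⊆e) =
    ≤-trans (Φ-monotone us c⊆e) (Φ-true∷-≥ us e u)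
  Φ-monotone (u ∷ us) {false ∷ c} (b≤b ∷ c⊆e) = Φ-monotone us c⊆e
  Φ-monotone (u ∷ us) {true ∷ c} {true ∷ e} (b≤b ∷ c⊆e) with inSpan⊎separated us c u
  ... | inj₁ u∈ = begin
    Φ (u ∷ us) (true ∷ c) ≡⟨ Φ-true∷-inSpan us c u u∈ ⟩
    2 * Φ us c            ≤⟨ *-monoʳ-≤ 2 (Φ-monotone us c⊆e) ⟩
    2 * Φ us e            ≡⟨ Φ-true∷-inSpan us e u (inSpan-mono c⊆e u∈) ⟨
    Φ (u ∷ us) (true ∷ e) ∎
    where open ≤-Reasoning
  ... | inj₂ u∉ = begin
    Φ (u ∷ us) (true ∷ c) ≡⟨ Φ-true∷-separated us c u u∉ ⟩
    Φ us c                ≤⟨ Φ-monotone us c⊆e ⟩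
    Φ us e                ≤⟨ Φ-true∷-≥ us e u ⟩
    Φ (u ∷ us) (true ∷ e) ∎
    where open ≤-Reasoning

  2ⁿ≤Φ : ∀ {n k} (us : Vec (F2^ n) k) (c : Vec Bool k) → 2 ^ n ≤ Φ us c
  2ⁿ≤Φ {n} []  []          = ≤-reflexive (sym (Φ-[] n))
  2ⁿ≤Φ (u ∷ us) (false ∷ c) = 2ⁿ≤Φ us c
  2ⁿ≤Φ (u ∷ us) (true ∷ c)  = ≤-trans (2ⁿ≤Φ us c) (Φ-true∷-≥ us c u)

  LinearlyIndependent : ∀ {n k} → Vec (F2^ n) k → Vec Bool k → Set
  LinearlyIndependent {k = k} us c = ∀ d → d ⊆ c → linComb d us ≡ zeroV → d ≡ empty k

  independent-tail : ∀ {n k} (u : F2^ n) (us : Vec (F2^ n) k) (b : Bool) (c : Vec Bool k) →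
                     LinearlyIndependent (u ∷ us) (b ∷ c) → LinearlyIndependent us c
  independent-tail u us b c ind d d⊆c d·us≡0 =
    cong Vec.tail (ind (false ∷ d) (≤-minimum b ∷ d⊆c) (trans (linComb-false∷ u d us) d·us≡0))

  addV≡zeroV⇒≡ : ∀ {n} {u v : F2^ n} → addV u v ≡ zeroV → u ≡ v
  addV≡zeroV⇒≡ {u = u} {v} u+v≡0 = begin
    u                 ≡⟨ addV-cancelʳ u v ⟨
    addV (addV u v) v ≡⟨ cong (λ x → addV x v) u+v≡0 ⟩
    addV zeroV v      ≡⟨ addV-identityˡ v ⟩
    v                 ∎
    where open ≡-Reasoning

  independent⇒separated : ∀ {n k} (u : F2^ n) (us : Vec (F2^ n) k) (c : Vec Bool k) →
                          LinearlyIndependent (u ∷ us) (true ∷ c) → Separated us c u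
  independent⇒separated u us c ind with inSpan⊎separated us c u
  ... | inj₂ u∉ = u∉
  ... | inj₁ (d , d⊆c , d·us≡u) = contradiction (cong Vec.head (ind (true ∷ d) (b≤b ∷ d⊆c) u+u≡0)) λ ()
    where
    u+u≡0 : linComb (true ∷ d) (u ∷ us) ≡ zeroV
    u+u≡0 = trans (linComb-true∷ u d us) (trans (cong (addV u) d·us≡u) (addV-self u))

  independent⇒Φ≡2ⁿ : ∀ {n k} (us : Vec (F2^ n) k) (c : Vec Bool k) →
                     LinearlyIndependent us c → Φ us c ≡ 2 ^ n
  independent⇒Φ≡2ⁿ {n} [] []             _   = Φ-[] n
  independent⇒Φ≡2ⁿ (u ∷ us) (false ∷ c) ind = independent⇒Φ≡2ⁿ us c (independent-tail u us false c ind)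
  independent⇒Φ≡2ⁿ (u ∷ us) (true ∷ c)  ind =
    trans (Φ-true∷-separated us c u (independent⇒separated u us c ind))
          (independent⇒Φ≡2ⁿ us c (independent-tail u us true c ind))

  Φ≡2ⁿ-tail : ∀ {n k} (u : F2^ n) (us : Vec (F2^ n) k) (b : Bool) (c : Vec Bool k) →
              Φ (u ∷ us) (b ∷ c) ≡ 2 ^ n → Φ us c ≡ 2 ^ n
  Φ≡2ⁿ-tail u us false c Φ≡2ⁿ = Φ≡2ⁿ
  Φ≡2ⁿ-tail u us true  c Φ≡2ⁿ =
    ≤-antisym (≤-trans (Φ-true∷-≥ us c u) (≤-reflexive Φ≡2ⁿ)) (2ⁿ≤Φ us c)

  Φ≡2ⁿ⇒separated : ∀ {n k} (u : F2^ n) (us : Vec (F2^ n) k) (c : Vec Bool k) →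
                   Φ (u ∷ us) (true ∷ c) ≡ 2 ^ n → Separated us c u
  Φ≡2ⁿ⇒separated {n} u us c Φ≡2ⁿ with inSpan⊎separated us c u
  ... | inj₂ u∉ = u∉
  ... | inj₁ u∈ = contradiction doubled (<⇒≱ (m<m+n (Φ us c) (≤-trans (≤-trans (m^n>0 2 n) (2ⁿ≤Φ us c)) (m≤m+n _ 0))))
    where
    doubled : Φ us c + (Φ us c + 0) ≤ Φ us c
    doubled = begin
      2 * Φ us c            ≡⟨ Φ-true∷-inSpan us c u u∈ ⟨
      Φ (u ∷ us) (true ∷ c) ≡⟨ Φ≡2ⁿ ⟩
      2 ^ n                 ≤⟨ 2ⁿ≤Φ us c ⟩
      Φ us c                ∎
      where open ≤-Reasoning

  Φ≡2ⁿ⇒independent : ∀ {n k} (us : Vec (F2^ n) k) (c : Vec Bool k) →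
                     Φ us c ≡ 2 ^ n → LinearlyIndependent us c
  Φ≡2ⁿ⇒independent []       []      _     []          []           _ = refl
  Φ≡2ⁿ⇒independent (u ∷ us) (b ∷ c) Φ≡2ⁿ (false ∷ d) (_ ∷ d⊆c) d·us≡0 =
    cong (false ∷_) (Φ≡2ⁿ⇒independent us c (Φ≡2ⁿ-tail u us b c Φ≡2ⁿ) d d⊆c
                       (trans (sym (linComb-false∷ u d us)) d·us≡0))
  Φ≡2ⁿ⇒independent (u ∷ us) (true ∷ c) Φ≡2ⁿ (true ∷ d) (b≤b ∷ d⊆c) d·us≡0
    with Φ≡2ⁿ⇒separated u us c Φ≡2ⁿ
  ... | r , ⊥r , r·u =
    contradiction (trans (sym r·u) (trans (cong (dot r) u≡d·us) (orthogonal-linComb us r d⊆c ⊥r))) λ ()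
    where
    u≡d·us : u ≡ linComb d us
    u≡d·us = addV≡zeroV⇒≡ (trans (sym (linComb-true∷ u d us)) d·us≡0)

  basis : ∀ {n k} (us : Vec (F2^ n) k) →
          ∃[ c ] Φ us c ≡ 2 ^ n × (∀ r → orthogonal us c r ≡ orthogonal us (full k) r)
  basis {n} [] = [] , Φ-[] n , λ _ → refl
  basis (u ∷ us) with basis us
  ... | c , Φc≡2ⁿ , ⊥c≗⊥full with inSpan⊎separated us c u
  ...   | inj₁ u∈ = false ∷ c , Φc≡2ⁿ , λ r → begin
    orthogonal us c r                       ≡⟨ orthogonal-inSpan us c u∈ r ⟨
    orthogonal us c r ∧ not (dot r u)       ≡⟨ ∧-comm (orthogonal us c r) _ ⟩
    not (dot r u) ∧ orthogonal us c r       ≡⟨ cong (not (dot r u) ∧_) (⊥c≗⊥full r) ⟩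
    not (dot r u) ∧ orthogonal us (full _) r ∎
    where open ≡-Reasoning
  ...   | inj₂ u∉ = true ∷ c , trans (Φ-true∷-separated us c u u∉) Φc≡2ⁿ ,
                    λ r → cong (not (dot r u) ∧_) (⊥c≗⊥full r)

  2^-cancel-≤ : ∀ {a b} → 2 ^ a ≤ 2 ^ b → a ≤ b
  2^-cancel-≤ 2ᵃ≤2ᵇ = ≮⇒≥ (λ b<a → <⇒≱ (^-monoʳ-< 2 (s≤s (s≤s z≤n)) b<a) 2ᵃ≤2ᵇ)

  independent⇒weight≤basis : ∀ {n k} (us : Vec (F2^ n) k) (c e : Vec Bool k) →
                             Φ us c ≡ 2 ^ n → (∀ r → orthogonal us c r ≡ orthogonal us (full k) r) →
                             LinearlyIndependent us e → weight e ≤ weight c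
  independent⇒weight≤basis {n} {k} us c e Φc≡2ⁿ ⊥c≗⊥full ind =
    2^-cancel-≤ (*-cancelˡ-≤ (annihilatorSize us c) {{Zc≢0}} (begin
      annihilatorSize us c * 2 ^ weight e
        ≡⟨ cong (_* 2 ^ weight e) (count-cong (allVecs n) ⊥c≗⊥full) ⟩
      annihilatorSize us (full k) * 2 ^ weight e
        ≤⟨ *-monoˡ-≤ (2 ^ weight e) (annihilatorSize-antitone us (⊆-full e)) ⟩
      Φ us e                                ≡⟨ independent⇒Φ≡2ⁿ us e ind ⟩
      2 ^ n                                 ≡⟨ Φc≡2ⁿ ⟨
      annihilatorSize us c * 2 ^ weight c   ∎))
    where
    open ≤-Reasoning
    Zc≢0 : NonZero (annihilatorSize us c)
    Zc≢0 = ≢-nonZero λ Zc≡0 → n>0⇒n≢0 (m^n>0 2 n) (trans (sym Φc≡2ⁿ) (cong (_* 2 ^ weight c) Zc≡0))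

  ∈-allVecs : ∀ {k} (c : Vec Bool k) → c ∈ allVecs k
  ∈-allVecs []          = here refl
  ∈-allVecs {suc k} (false ∷ c) = ∈-concatMap⁺ (λ b → map (b ∷_) (allVecs k)) {xs = false ∷ true ∷ []}
                                   (here (∈-map⁺ (false ∷_) (∈-allVecs c)))
  ∈-allVecs {suc k} (true ∷ c)  = ∈-concatMap⁺ (λ b → map (b ∷_) (allVecs k)) {xs = false ∷ true ∷ []}
                                   (there (here (∈-map⁺ (true ∷_) (∈-allVecs c))))

  and-map⁺ : ∀ {A : Set} (P : A → Bool) (xs : List A) → (∀ x → P x ≡ true) → and (map P xs) ≡ true
  and-map⁺ P []       _  = refl
  and-map⁺ P (x ∷ xs) ∀P = cong₂ _∧_ (∀P x) (and-map⁺ P xs ∀P)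

  and-map⁻ : ∀ {A : Set} (P : A → Bool) {x : A} {xs : List A} →
             and (map P xs) ≡ true → x ∈ xs → P x ≡ true
  and-map⁻ P all (here refl) = ∧-conicalˡ _ _ all
  and-map⁻ P all (there x∈) = and-map⁻ P (∧-conicalʳ _ _ all) x∈

  or-map⁺ : ∀ {A : Set} (P : A → Bool) {x : A} {xs : List A} →
            x ∈ xs → P x ≡ true → or (map P xs) ≡ true
  or-map⁺ P {xs = x ∷ xs} (here refl) Px = cong (_∨ or (map P xs)) Px
  or-map⁺ P {xs = y ∷ _}  (there x∈)  Px = trans (cong (P y ∨_) (or-map⁺ P x∈ Px)) (∨-zeroʳ (P y))

  or-map⁻ : ∀ {A : Set} (P : A → Bool) (xs : List A) → or (map P xs) ≡ true → ∃[ x ] P x ≡ true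
  or-map⁻ P (x ∷ xs) any with P x in Px
  ... | true  = x , Px
  ... | false = or-map⁻ P xs any

  eqV-sound : ∀ {n} (a b : F2^ n) → eqV a b ≡ true → a ≡ b
  eqV-sound []          []          _ = refl
  eqV-sound (false ∷ a) (false ∷ b) e = cong (false ∷_) (eqV-sound a b e)
  eqV-sound (true ∷ a)  (true ∷ b)  e = cong (true ∷_) (eqV-sound a b e)

  eqV-refl : ∀ {n} (a : F2^ n) → eqV a a ≡ true
  eqV-refl []          = refl
  eqV-refl (false ∷ a) = eqV-refl a
  eqV-refl (true ∷ a)  = eqV-refl a

  _⊆ᵇ_ : ∀ {k} → Vec Bool k → Vec Bool k → Bool
  d ⊆ᵇ c = and (toList (zipWith (λ dᵢ cᵢ → not dᵢ ∨ cᵢ) d c))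

  ⊆ᵇ⇒⊆ : ∀ {k} (d c : Vec Bool k) → d ⊆ᵇ c ≡ true → d ⊆ c
  ⊆ᵇ⇒⊆ []          []          _ = []
  ⊆ᵇ⇒⊆ (false ∷ d) (b ∷ c)     h = ≤-minimum b ∷ ⊆ᵇ⇒⊆ d c h
  ⊆ᵇ⇒⊆ (true ∷ d)  (true ∷ c)  h = b≤b ∷ ⊆ᵇ⇒⊆ d c h

  ⊆⇒⊆ᵇ : ∀ {k} {d c : Vec Bool k} → d ⊆ c → d ⊆ᵇ c ≡ true
  ⊆⇒⊆ᵇ []                      = refl
  ⊆⇒⊆ᵇ (f≤t ∷ d⊆c)             = ⊆⇒⊆ᵇ d⊆c
  ⊆⇒⊆ᵇ {d = false ∷ _} (b≤b ∷ d⊆c) = ⊆⇒⊆ᵇ d⊆c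
  ⊆⇒⊆ᵇ {d = true ∷ _}  (b≤b ∷ d⊆c) = ⊆⇒⊆ᵇ d⊆c

  independentSub⇒independent : ∀ {n k} (us : Vec (F2^ n) k) (c : Vec Bool k) →
                               independentSub us c ≡ true → LinearlyIndependent us c
  independentSub⇒independent {n} {k} us c h d d⊆c d·us≡0 = eqV-sound d (empty k) (begin
    eqV d zeroV
      ≡⟨ cong₂ (λ x y → not x ∨ not y ∨ eqV d zeroV) (⊆⇒⊆ᵇ d⊆c)
               (trans (cong (λ v → eqV v zeroV) d·us≡0) (eqV-refl (zeroV {n}))) ⟨
    not (d ⊆ᵇ c) ∨ not (eqV (linComb d us) zeroV) ∨ eqV d zeroV
      ≡⟨ and-map⁻ _ h (∈-allVecs d) ⟩
    true ∎)
    where open ≡-Reasoning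

  independent⇒independentSub : ∀ {n k} (us : Vec (F2^ n) k) (c : Vec Bool k) →
                               LinearlyIndependent us c → independentSub us c ≡ true
  independent⇒independentSub {k = k} us c ind = and-map⁺ _ (allVecs k) certified
    where
    certified : ∀ d → not (d ⊆ᵇ c) ∨ not (eqV (linComb d us) zeroV) ∨ eqV d zeroV ≡ true
    certified d with d ⊆ᵇ c in d⊆ᵇc | eqV (linComb d us) zeroV in d·us≡ᵇ0
    ... | false | _     = refl
    ... | true  | false = refl
    ... | true  | true  = trans (cong (λ x → eqV x zeroV)
                                  (ind d (⊆ᵇ⇒⊆ d c d⊆ᵇc) (eqV-sound _ _ d·us≡ᵇ0)))
                                (eqV-refl (empty k))

  ≤-foldr-⊔ : ∀ {A : Set} (f : A → ℕ) {x : A} {xs : List A} → x ∈ xs → f x ≤ foldr _⊔_ 0 (map f xs)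
  ≤-foldr-⊔ f (here refl)             = m≤m⊔n _ _
  ≤-foldr-⊔ f {xs = y ∷ _} (there x∈) = ≤-trans (≤-foldr-⊔ f x∈) (m≤n⊔m (f y) _)

  foldr-⊔-lub : ∀ {A : Set} (f : A → ℕ) (xs : List A) {b : ℕ} → (∀ x → f x ≤ b) →
                foldr _⊔_ 0 (map f xs) ≤ b
  foldr-⊔-lub f []       _   = z≤n
  foldr-⊔-lub f (x ∷ xs) f≤b = ⊔-lub (f≤b x) (foldr-⊔-lub f xs f≤b)

  rank-formula : ∀ {n k} (us : Vec (F2^ n) k) → annihilatorSize us (full k) * 2 ^ rank us ≡ 2 ^ n
  rank-formula {n} {k} us with basis us
  ... | c , Φc≡2ⁿ , ⊥c≗⊥full = begin
    annihilatorSize us (full k) * 2 ^ rank us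
      ≡⟨ cong₂ (λ z r → z * 2 ^ r) (count-cong (allVecs n) ⊥c≗⊥full) rank≡weight ⟨
    Φ us c ≡⟨ Φc≡2ⁿ ⟩
    2 ^ n  ∎
    where
    open ≡-Reasoning
    dim : Vec Bool k → ℕ
    dim e = if independentSub us e then card e else 0
    dim≤weight : ∀ e → dim e ≤ weight c
    dim≤weight e with independentSub us e in ind
    ... | false = z≤n
    ... | true  = independent⇒weight≤basis us c e Φc≡2ⁿ ⊥c≗⊥full (independentSub⇒independent us e ind)
    weight≤dim : weight c ≤ dim c
    weight≤dim = ≤-reflexive (sym (cong (if_then card c else 0)
                   (independent⇒independentSub us c (Φ≡2ⁿ⇒independent us c Φc≡2ⁿ))))
    rank≡weight : weight c ≡ rank us
    rank≡weight = ≤-antisym (≤-trans weight≤dim (≤-foldr-⊔ dim (∈-allVecs c)))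
                            (foldr-⊔-lub dim (allVecs k) dim≤weight)

  others : ∀ {k} → Fin k → Vec Bool k
  others {k} j = full k [ j ]≔ false

  ⊆-others : ∀ {k} (c : Vec Bool k) (j : Fin k) → lookup c j ≡ false → c ⊆ others j
  ⊆-others (false ∷ c) zero    _    = b≤b ∷ ⊆-full c
  ⊆-others (b ∷ c)     (suc j) cⱼ≡f = ≤-maximum b ∷ ⊆-others c j cⱼ≡f

  ⊆-others⇒lookup≡false : ∀ {k} {d : Vec Bool k} (j : Fin k) → d ⊆ others j → lookup d j ≡ false
  ⊆-others⇒lookup≡false zero    (b≤b ∷ _)  = refl
  ⊆-others⇒lookup≡false (suc j) (_ ∷ d⊆) = ⊆-others⇒lookup≡false j d⊆

  others-[]≔true : ∀ {k} (j : Fin k) → others j [ j ]≔ true ≡ full k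
  others-[]≔true {k} j = trans ([]≔-idempotent (full k) j)
    (trans (cong (full k [ j ]≔_) (sym (lookup-replicate j true))) ([]≔-lookup (full k) j))

  weight-[]≔true : ∀ {k} (c : Vec Bool k) (j : Fin k) → lookup c j ≡ false →
                   weight (c [ j ]≔ true) ≡ suc (weight c)
  weight-[]≔true (false ∷ c) zero    _    = refl
  weight-[]≔true (false ∷ c) (suc j) cⱼ≡f = weight-[]≔true c j cⱼ≡f
  weight-[]≔true (true ∷ c)  (suc j) cⱼ≡f = cong suc (weight-[]≔true c j cⱼ≡f)

  weight-full : ∀ k → weight (full k) ≡ k
  weight-full zero    = refl
  weight-full (suc k) = cong suc (weight-full k)

  noColoops⇒inSpan : ∀ {n k} (us : Vec (F2^ n) k) → noColoops us ≡ true →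
                     ∀ j → InSpan us (others j) (lookup us j)
  noColoops⇒inSpan {k = k} us noColoop j with inSpanOfOthers us j in inSpanᵇ
  ... | false = contradiction
    (trans (sym noColoop) (cong not (or-map⁺ (isColoop us) (∈-toList⁺ (∈-allFin⁺ j)) (cong not inSpanᵇ))))
    λ ()
  ... | true with or-map⁻ (λ d → not (lookup d j) ∧ eqV (linComb d us) (lookup us j)) (allVecs k) inSpanᵇ
  ...   | d , witness = d , ⊆-others d j (not-injective (∧-conicalˡ _ _ witness)) ,
                        eqV-sound _ _ (∧-conicalʳ (not (lookup d j)) _ witness)

  coloop⇒separated : ∀ {n k} (us : Vec (F2^ n) k) → noColoops us ≡ false →
                     ∃[ j ] Separated us (others j) (lookup us j)
  coloop⇒separated {k = k} us coloop with or-map⁻ (isColoop us) (toList (allFin k)) (not-injective coloop)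
  ... | j , isColoopⱼ with inSpan⊎separated us (others j) (lookup us j)
  ...   | inj₂ sep = j , sep
  ...   | inj₁ (d , d⊆others , d·us≡uⱼ) = contradiction
    (trans (sym isColoopⱼ) (cong not (or-map⁺ _ (∈-allVecs d)
      (cong₂ _∧_ (cong not (⊆-others⇒lookup≡false j d⊆others))
                 (trans (cong (λ v → eqV v (lookup us j)) d·us≡uⱼ) (eqV-refl (lookup us j)))))))
    λ ()

  coloop-halves : ∀ {n k} (us : Vec (F2^ n) k) (j : Fin k) → Separated us (others j) (lookup us j) →
                  ∀ c → lookup c j ≡ false →
                  annihilatorSize us c ≡ 2 * annihilatorSize us (c [ j ]≔ true)
  coloop-halves us j (r , ⊥r , r·uⱼ) c cⱼ≡f =
    annihilatorSize-separated us c j (r , orthogonal-antitone us r (⊆-others c j cⱼ≡f) ⊥r , r·uⱼ)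

  -- Without coloops uₗ is spanned by the other entries, so the mask missing only l has the same
  -- annihilator as the full mask; monotonicity of Φ compares c with that mask.
  annihilatorSize-nonFull : ∀ {n k} (us : Vec (F2^ n) k) → noColoops us ≡ true →
                            ∀ c l → lookup c l ≡ false →
                            annihilatorSize us c * 2 ^ suc (weight c) ≤ annihilatorSize us (full k) * 2 ^ k
  annihilatorSize-nonFull {k = k} us noColoop c l cₗ≡f = begin
    annihilatorSize us c * (2 * 2 ^ weight c) ≡⟨ x∙yz≈y∙xz (annihilatorSize us c) 2 _ ⟩
    2 * Φ us c                                ≤⟨ *-monoʳ-≤ 2 (Φ-monotone us (⊆-others c l cₗ≡f)) ⟩
    2 * Φ us (others l)                       ≡⟨ x∙yz≈y∙xz (annihilatorSize us (others l)) 2 _ ⟨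
    annihilatorSize us (others l) * 2 ^ suc (weight (others l))
      ≡⟨ cong₂ (λ z w → z * 2 ^ w) Zothers≡Zfull weight-others ⟩
    annihilatorSize us (full k) * 2 ^ k       ∎
    where
    open ≤-Reasoning
    Zothers≡Zfull : annihilatorSize us (others l) ≡ annihilatorSize us (full k)
    Zothers≡Zfull = trans (sym (annihilatorSize-inSpan us (others l) l (noColoops⇒inSpan us noColoop l)))
                          (cong (annihilatorSize us) (others-[]≔true l))
    weight-others : suc (weight (others l)) ≡ k
    weight-others = trans (sym (weight-[]≔true (others l) l (lookup∘update l (full k) false)))
                          (trans (cong weight (others-[]≔true l)) (weight-full k))

  Φ-singleton : ∀ {n} (x : F2^ n) → x ≢ zeroV → Φ (x ∷ []) (true ∷ []) ≡ 2 ^ n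
  Φ-singleton {n} x x≢0 with zeroV-or-detected x
  ... | inj₁ x≡0       = contradiction x≡0 x≢0
  ... | inj₂ (w , w·x) = trans (Φ-true∷-separated [] [] x (w , refl , w·x)) (Φ-[] n)

module Moments where

  open LinearAlgebra using (orthogonal)
  open Annihilators
    using (count; map-allVecs-suc; count-true-allVecs; annihilatorSize; full; rank-formula;
           coloop⇒separated; coloop-halves; annihilatorSize-nonFull; Φ-singleton)
  open import Data.Bool as Bool using (Bool; true; false; _∧_; not; if_then_else_)
  open import Data.Fin using (Fin; zero; suc)
  import Data.Integer as ℤ
  import Data.Integer.Properties as ℤ
  open import Data.List using (List; []; _∷_; _++_; map; concatMap; filter; length)
  open import Data.List.Properties using (map-++; map-∘)
  open import Data.Nat as ℕ using (ℕ; zero; suc)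
  import Data.Nat.Properties as ℕ
  import Data.Nat.Coprimality as Coprime
  open import Data.Product using (∃-syntax; _×_; _,_; proj₁; proj₂)
  open import Data.Rational as ℚ using (ℚ; 0ℚ; 1ℚ; _+_; _*_; _-_; -_; _≤_; mkℚ)
  open import Data.Rational.Properties
  open import Data.Rational.Solver using (module +-*-Solver)
  open import Data.Sum using (_⊎_; inj₁; inj₂)
  open import Data.Vec using (Vec; []; _∷_; lookup; _[_]≔_)
  open import Function using (_∘_)
  open import Relation.Binary.PropositionalEquality
  open import Relation.Nullary using (yes; no; Dec)
  open import Algebra.Properties.CommutativeSemigroup ℕ.*-commutativeSemigroup using (interchange)
  open +-*-Solver

  toℚ-suc : ∀ k → toℚ (suc k) ≡ 1ℚ + toℚ k
  toℚ-suc k rewrite normalize-coprime (Coprime.sym (Coprime.1-coprimeTo k)) =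
    sym (cong (ℚ._/ 1) (cong (λ z → ℤ.+ 1 ℤ.+ z) (ℤ.*-identityʳ (ℤ.+ k))))

  toℚ-homo-+ : ∀ a b → toℚ (a ℕ.+ b) ≡ toℚ a + toℚ b
  toℚ-homo-+ zero    b = sym (+-identityˡ _)
  toℚ-homo-+ (suc a) b = begin
    toℚ (suc (a ℕ.+ b))      ≡⟨ toℚ-suc (a ℕ.+ b) ⟩
    1ℚ + toℚ (a ℕ.+ b)       ≡⟨ cong (1ℚ +_) (toℚ-homo-+ a b) ⟩
    1ℚ + (toℚ a + toℚ b)     ≡⟨ +-assoc 1ℚ (toℚ a) (toℚ b) ⟨
    1ℚ + toℚ a + toℚ b       ≡⟨ cong (_+ toℚ b) (toℚ-suc a) ⟨
    toℚ (suc a) + toℚ b      ∎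
    where open ≡-Reasoning

  toℚ-homo-* : ∀ a b → toℚ (a ℕ.* b) ≡ toℚ a * toℚ b
  toℚ-homo-* zero    b = sym (*-zeroˡ (toℚ b))
  toℚ-homo-* (suc a) b = begin
    toℚ (b ℕ.+ a ℕ.* b)      ≡⟨ toℚ-homo-+ b (a ℕ.* b) ⟩
    toℚ b + toℚ (a ℕ.* b)    ≡⟨ cong (toℚ b +_) (toℚ-homo-* a b) ⟩
    toℚ b + toℚ a * toℚ b    ≡⟨ solve 2 (λ x y → y :+ x :* y := (con 1ℚ :+ x) :* y) refl (toℚ a) (toℚ b) ⟩
    (1ℚ + toℚ a) * toℚ b     ≡⟨ cong (_* toℚ b) (toℚ-suc a) ⟨
    toℚ (suc a) * toℚ b      ∎
    where open ≡-Reasoning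

  toℚ-nonNeg : ∀ a → 0ℚ ≤ toℚ a
  toℚ-nonNeg a rewrite normalize-coprime (Coprime.sym (Coprime.1-coprimeTo a)) =
    nonNegative⁻¹ (mkℚ (ℤ.+ a) 0 _)

  toℚ-mono-≤ : ∀ {a b} → a ℕ.≤ b → toℚ a ≤ toℚ b
  toℚ-mono-≤ {a} {b} a≤b = begin
    toℚ a                   ≡⟨ +-identityʳ (toℚ a) ⟨
    toℚ a + 0ℚ              ≤⟨ +-monoʳ-≤ (toℚ a) (toℚ-nonNeg (b ℕ.∸ a)) ⟩
    toℚ a + toℚ (b ℕ.∸ a)   ≡⟨ toℚ-homo-+ a (b ℕ.∸ a) ⟨
    toℚ (a ℕ.+ (b ℕ.∸ a))   ≡⟨ cong toℚ (ℕ.m+[n∸m]≡n a≤b) ⟩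
    toℚ b                   ∎
    where open ≤-Reasoning

  *-nonNeg : ∀ {a b} → 0ℚ ≤ a → 0ℚ ≤ b → 0ℚ ≤ a * b
  *-nonNeg {a} {b} 0≤a 0≤b =
    subst (_≤ a * b) (*-zeroʳ a) (*-monoˡ-≤-nonNeg a {{ℚ.nonNegative 0≤a}} 0≤b)

  powℚ-+ : ∀ x a b → powℚ x (a ℕ.+ b) ≡ powℚ x a * powℚ x b
  powℚ-+ x zero    b = sym (*-identityˡ _)
  powℚ-+ x (suc a) b = trans (cong (x *_) (powℚ-+ x a b)) (sym (*-assoc x _ _))

  powℚ-* : ∀ x a b → powℚ x (a ℕ.* b) ≡ powℚ (powℚ x a) b
  powℚ-* x a zero    rewrite ℕ.*-zeroʳ a = refl
  powℚ-* x a (suc b) rewrite ℕ.*-suc a b =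
    trans (powℚ-+ x a (a ℕ.* b)) (cong (powℚ x a *_) (powℚ-* x a b))

  powℚ-distrib-* : ∀ x y m → powℚ (x * y) m ≡ powℚ x m * powℚ y m
  powℚ-distrib-* x y zero    = refl
  powℚ-distrib-* x y (suc m) rewrite powℚ-distrib-* x y m =
    solve 4 (λ x y a b → (x :* y) :* (a :* b) := (x :* a) :* (y :* b)) refl x y (powℚ x m) (powℚ y m)

  powℚ-one : ∀ m → powℚ 1ℚ m ≡ 1ℚ
  powℚ-one zero    = refl
  powℚ-one (suc m) rewrite powℚ-one m = refl

  powℚ-nonNeg : ∀ x m → 0ℚ ≤ x → 0ℚ ≤ powℚ x m
  powℚ-nonNeg x zero    _   = ℚ.*≤* (ℤ.+≤+ ℕ.z≤n)
  powℚ-nonNeg x (suc m) 0≤x = *-nonNeg 0≤x (powℚ-nonNeg x m 0≤x)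

  powℚ-toℚ : ∀ a m → powℚ (toℚ a) m ≡ toℚ (a ℕ.^ m)
  powℚ-toℚ a zero    = refl
  powℚ-toℚ a (suc m) = trans (cong (toℚ a *_) (powℚ-toℚ a m)) (sym (toℚ-homo-* a (a ℕ.^ m)))

  ½-nonNeg : 0ℚ ≤ ½
  ½-nonNeg = ℚ.*≤* (ℤ.+≤+ ℕ.z≤n)

  ½^-nonNeg : ∀ t → 0ℚ ≤ powℚ ½ t
  ½^-nonNeg t = powℚ-nonNeg ½ t ½-nonNeg

  ½^*2^≡1 : ∀ t → powℚ ½ t * powℚ (toℚ 2) t ≡ 1ℚ
  ½^*2^≡1 t = trans (sym (powℚ-distrib-* ½ (toℚ 2) t)) (powℚ-one t)

  ½^-scale-≤ : ∀ a b s t → a ℕ.* 2 ℕ.^ s ℕ.≤ b ℕ.* 2 ℕ.^ t → toℚ a * powℚ ½ t ≤ toℚ b * powℚ ½ s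
  ½^-scale-≤ a b s t a2ˢ≤b2ᵗ = begin
    toℚ a * powℚ ½ t                                      ≡⟨ unscale a s ⟨
    toℚ (a ℕ.* 2 ℕ.^ s) * (powℚ ½ s * powℚ ½ t)
      ≤⟨ *-monoʳ-≤-nonNeg (powℚ ½ s * powℚ ½ t) {{ℚ.nonNegative (*-nonNeg (½^-nonNeg s) (½^-nonNeg t))}}
                          (toℚ-mono-≤ a2ˢ≤b2ᵗ) ⟩
    toℚ (b ℕ.* 2 ℕ.^ t) * (powℚ ½ s * powℚ ½ t)           ≡⟨ cong (toℚ (b ℕ.* 2 ℕ.^ t) *_) (*-comm (powℚ ½ s) _) ⟩
    toℚ (b ℕ.* 2 ℕ.^ t) * (powℚ ½ t * powℚ ½ s)           ≡⟨ unscale b t ⟩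
    toℚ b * powℚ ½ s                                      ∎
    where
    open ≤-Reasoning
    unscale : ∀ x u {v} → toℚ (x ℕ.* 2 ℕ.^ u) * (powℚ ½ u * v) ≡ toℚ x * v
    unscale x u {v} = begin-equality
      toℚ (x ℕ.* 2 ℕ.^ u) * (powℚ ½ u * v)
        ≡⟨ cong (_* (powℚ ½ u * v)) (trans (toℚ-homo-* x _) (cong (toℚ x *_) (sym (powℚ-toℚ 2 u)))) ⟩
      toℚ x * powℚ (toℚ 2) u * (powℚ ½ u * v)
        ≡⟨ solve 4 (λ X T H V → (X :* T) :* (H :* V) := X :* ((H :* T) :* V)) refl (toℚ x) (powℚ (toℚ 2) u) (powℚ ½ u) v ⟩
      toℚ x * (powℚ ½ u * powℚ (toℚ 2) u * v)
        ≡⟨ cong (λ z → toℚ x * (z * v)) (½^*2^≡1 u) ⟩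
      toℚ x * (1ℚ * v)
        ≡⟨ cong (toℚ x *_) (*-identityˡ v) ⟩
      toℚ x * v ∎

  ½^-scale-≡ : ∀ a s t → a ℕ.* 2 ℕ.^ s ≡ 2 ℕ.^ t → toℚ a * powℚ ½ t ≡ powℚ ½ s
  ½^-scale-≡ a s t a2ˢ≡2ᵗ = trans
    (≤-antisym (½^-scale-≤ a 1 s t (ℕ.≤-reflexive (trans a2ˢ≡2ᵗ (sym (ℕ.*-identityˡ _)))))
               (½^-scale-≤ 1 a t s (ℕ.≤-reflexive (trans (ℕ.*-identityˡ _) (sym a2ˢ≡2ᵗ)))))
    (*-identityˡ (powℚ ½ s))

  infix 10 ∑[_]_
  ∑[_]_ : ∀ {A : Set} → List A → (A → ℚ) → ℚ
  ∑[ xs ] f = sumℚ (map f xs)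

  sumℚ-++ : (xs ys : List ℚ) → sumℚ (xs ++ ys) ≡ sumℚ xs + sumℚ ys
  sumℚ-++ []       ys = sym (+-identityˡ _)
  sumℚ-++ (x ∷ xs) ys = trans (cong (x +_) (sumℚ-++ xs ys)) (sym (+-assoc x _ _))

  ∑-cong : ∀ {A : Set} (xs : List A) {f g : A → ℚ} → (∀ x → f x ≡ g x) → ∑[ xs ] f ≡ ∑[ xs ] g
  ∑-cong []       _   = refl
  ∑-cong (x ∷ xs) f≗g = cong₂ _+_ (f≗g x) (∑-cong xs f≗g)

  ∑-zero : ∀ {A : Set} (xs : List A) → ∑[ xs ] (λ _ → 0ℚ) ≡ 0ℚ
  ∑-zero []       = refl
  ∑-zero (x ∷ xs) = trans (+-identityˡ _) (∑-zero xs)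

  ∑-+ : ∀ {A : Set} (xs : List A) (f g : A → ℚ) → ∑[ xs ] (λ x → f x + g x) ≡ ∑[ xs ] f + ∑[ xs ] g
  ∑-+ []       f g = refl
  ∑-+ (x ∷ xs) f g rewrite ∑-+ xs f g =
    solve 4 (λ a b c d → (a :+ b) :+ (c :+ d) := (a :+ c) :+ (b :+ d)) refl (f x) (g x) (∑[ xs ] f) (∑[ xs ] g)

  ∑-*ˡ : ∀ {A : Set} (xs : List A) (a : ℚ) (f : A → ℚ) → a * (∑[ xs ] f) ≡ ∑[ xs ] (λ x → a * f x)
  ∑-*ˡ []       a f = *-zeroʳ a
  ∑-*ˡ (x ∷ xs) a f = trans (*-distribˡ-+ a (f x) _) (cong (a * f x +_) (∑-*ˡ xs a f))

  ∑-*ʳ : ∀ {A : Set} (xs : List A) (a : ℚ) (f : A → ℚ) → (∑[ xs ] f) * a ≡ ∑[ xs ] (λ x → f x * a)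
  ∑-*ʳ xs a f = trans (*-comm _ a) (trans (∑-*ˡ xs a f) (∑-cong xs (λ x → *-comm a (f x))))

  ∑-neg : ∀ {A : Set} (xs : List A) (f : A → ℚ) → - (∑[ xs ] f) ≡ ∑[ xs ] (λ x → - f x)
  ∑-neg []       f = refl
  ∑-neg (x ∷ xs) f = trans (neg-distrib-+ (f x) _) (cong (- f x +_) (∑-neg xs f))

  ∑-- : ∀ {A : Set} (xs : List A) (f g : A → ℚ) → (∑[ xs ] f) - (∑[ xs ] g) ≡ ∑[ xs ] (λ x → f x - g x)
  ∑-- xs f g = trans (cong ((∑[ xs ] f) +_) (∑-neg xs g)) (sym (∑-+ xs f (λ x → - g x)))

  ∑-concatMap : ∀ {A B : Set} (xs : List A) (h : A → List B) (f : B → ℚ) →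
                ∑[ concatMap h xs ] f ≡ ∑[ xs ] (λ x → ∑[ h x ] f)
  ∑-concatMap []       h f = refl
  ∑-concatMap (x ∷ xs) h f = trans (cong sumℚ (map-++ f (h x) (concatMap h xs)))
    (trans (sumℚ-++ (map f (h x)) _) (cong ((∑[ h x ] f) +_) (∑-concatMap xs h f)))

  ∑-swap : ∀ {A B : Set} (xs : List A) (ys : List B) (h : A → B → ℚ) →
           ∑[ xs ] (λ x → ∑[ ys ] (h x)) ≡ ∑[ ys ] (λ y → ∑[ xs ] (λ x → h x y))
  ∑-swap []       ys h = sym (∑-zero ys)
  ∑-swap (x ∷ xs) ys h = trans (cong ((∑[ ys ] (h x)) +_) (∑-swap xs ys h))
                               (sym (∑-+ ys (h x) (λ y → ∑[ xs ] (λ x → h x y))))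

  ∑-mono-≤ : ∀ {A : Set} (xs : List A) {f g : A → ℚ} → (∀ x → f x ≤ g x) → ∑[ xs ] f ≤ ∑[ xs ] g
  ∑-mono-≤ []       _   = ≤-refl
  ∑-mono-≤ (x ∷ xs) f≤g = +-mono-≤ (f≤g x) (∑-mono-≤ xs f≤g)

  ∑-sandwich : ∀ {A : Set} (xs : List A) {a b : ℚ} {f g : A → ℚ} →
               (∀ x → a * f x ≤ g x × g x ≤ b * f x) →
               a * ∑[ xs ] f ≤ ∑[ xs ] g × ∑[ xs ] g ≤ b * ∑[ xs ] f
  ∑-sandwich xs {a} {b} {f} bounds =
    ≤-trans (≤-reflexive (∑-*ˡ xs a f)) (∑-mono-≤ xs (proj₁ ∘ bounds)) ,
    ≤-trans (∑-mono-≤ xs (proj₂ ∘ bounds)) (≤-reflexive (sym (∑-*ˡ xs b f)))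

  ∑-allVecs-suc : ∀ {k} (f : Vec Bool (suc k) → ℚ) →
                  ∑[ allVecs (suc k) ] f ≡ (∑[ allVecs k ] (f ∘ (false ∷_))) + (∑[ allVecs k ] (f ∘ (true ∷_)))
  ∑-allVecs-suc {k} f = trans (cong sumℚ (map-allVecs-suc f)) (sumℚ-++ (map (f ∘ (false ∷_)) (allVecs k)) _)

  indicator : Bool → ℚ
  indicator b = if b then 1ℚ else 0ℚ

  ∑-indicator : ∀ {A : Set} (P : A → Bool) (xs : List A) → ∑[ xs ] (indicator ∘ P) ≡ toℚ (count P xs)
  ∑-indicator P []       = refl
  ∑-indicator P (x ∷ xs) with P x
  ... | true  = trans (cong (1ℚ +_) (∑-indicator P xs)) (sym (toℚ-suc (count P xs)))
  ... | false = trans (+-identityˡ _) (∑-indicator P xs)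

  ∑-const-allVecs : ∀ k (a : ℚ) → ∑[ allVecs k ] (λ _ → a) ≡ toℚ (2 ℕ.^ k) * a
  ∑-const-allVecs k a = begin
    ∑[ allVecs k ] (λ _ → a)                      ≡⟨ ∑-cong (allVecs k) (λ _ → *-identityˡ a) ⟨
    ∑[ allVecs k ] (λ _ → 1ℚ * a)                 ≡⟨ ∑-*ʳ (allVecs k) a (λ _ → 1ℚ) ⟨
    (∑[ allVecs k ] (λ _ → indicator true)) * a   ≡⟨ cong (_* a) (∑-indicator (λ _ → true) (allVecs k)) ⟩
    toℚ (count (λ _ → true) (allVecs k)) * a      ≡⟨ cong (λ z → toℚ z * a) (count-true-allVecs k) ⟩
    toℚ (2 ℕ.^ k) * a                             ∎
    where open ≡-Reasoning

  ∏ : ∀ {A : Set} {k} → (A → ℚ) → Vec A k → ℚ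
  ∏ f []       = 1ℚ
  ∏ f (x ∷ xs) = f x * ∏ f xs

  powℚ-∑ : ∀ {A : Set} (xs : List A) (f : A → ℚ) k → powℚ (∑[ xs ] f) k ≡ ∑[ allSeqs xs k ] (∏ f)
  powℚ-∑ xs f zero    = sym (+-identityʳ 1ℚ)
  powℚ-∑ xs f (suc k) = begin
    (∑[ xs ] f) * powℚ (∑[ xs ] f) k           ≡⟨ cong ((∑[ xs ] f) *_) (powℚ-∑ xs f k) ⟩
    (∑[ xs ] f) * (∑[ allSeqs xs k ] (∏ f))    ≡⟨ ∑-*ʳ xs _ f ⟩
    ∑[ xs ] (λ x → f x * (∑[ allSeqs xs k ] (∏ f)))
      ≡⟨ ∑-cong xs (λ x → trans (∑-*ˡ (allSeqs xs k) (f x) (∏ f)) (cong sumℚ (map-∘ (allSeqs xs k)))) ⟩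
    ∑[ xs ] (λ x → ∑[ map (x ∷_) (allSeqs xs k) ] (∏ f))
      ≡⟨ ∑-concatMap xs (λ x → map (x ∷_) (allSeqs xs k)) (∏ f) ⟨
    ∑[ allSeqs xs (suc k) ] (∏ f)              ∎
    where open ≡-Reasoning

  #false : ∀ {k} → Vec Bool k → ℕ
  #false []          = 0
  #false (false ∷ c) = suc (#false c)
  #false (true ∷ c)  = #false c

  ∏-selected : ∀ {A : Set} {k} → (A → ℚ) → Vec Bool k → Vec A k → ℚ
  ∏-selected f []      []       = 1ℚ
  ∏-selected f (b ∷ c) (x ∷ xs) = (if b then f x else 1ℚ) * ∏-selected f c xs

  ∏-selected-cong : ∀ {A : Set} {k} {f g : A → ℚ} (c : Vec Bool k) (xs : Vec A k) →
                    (∀ x → f x ≡ g x) → ∏-selected f c xs ≡ ∏-selected g c xs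
  ∏-selected-cong []          []       f≗g = refl
  ∏-selected-cong (false ∷ c) (x ∷ xs) f≗g = cong (1ℚ *_) (∏-selected-cong c xs f≗g)
  ∏-selected-cong (true ∷ c)  (x ∷ xs) f≗g = cong₂ _*_ (f≗g x) (∏-selected-cong c xs f≗g)

  ∏-selected-one : ∀ {A : Set} {k} (c : Vec Bool k) (xs : Vec A k) → ∏-selected (λ _ → 1ℚ) c xs ≡ 1ℚ
  ∏-selected-one []      []       = refl
  ∏-selected-one (b ∷ c) (x ∷ xs) = trans (cong (_* ∏-selected (λ _ → 1ℚ) c xs) (lemma b))
                                          (trans (*-identityˡ _) (∏-selected-one c xs))
    where
    lemma : ∀ b → (if b then 1ℚ else 1ℚ) ≡ 1ℚ
    lemma false = refl
    lemma true  = refl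

  ∏-selected-* : ∀ {A : Set} {k} (f g : A → ℚ) (c : Vec Bool k) (xs : Vec A k) →
                 ∏-selected (λ x → f x * g x) c xs ≡ ∏-selected f c xs * ∏-selected g c xs
  ∏-selected-* f g []          []       = refl
  ∏-selected-* f g (false ∷ c) (x ∷ xs) rewrite ∏-selected-* f g c xs =
    solve 2 (λ a b → con 1ℚ :* (a :* b) := (con 1ℚ :* a) :* (con 1ℚ :* b)) refl
      (∏-selected f c xs) (∏-selected g c xs)
  ∏-selected-* f g (true ∷ c)  (x ∷ xs) rewrite ∏-selected-* f g c xs =
    solve 4 (λ a b c d → (a :* b) :* (c :* d) := (a :* c) :* (b :* d)) refl
      (f x) (g x) (∏-selected f c xs) (∏-selected g c xs)

  ∏-binomial : ∀ {A : Set} {k} (f : A → ℚ) (p : ℚ) (xs : Vec A k) →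
               ∏ (λ x → f x - p) xs ≡ ∑[ allVecs k ] (λ c → powℚ (- p) (#false c) * ∏-selected f c xs)
  ∏-binomial f p []                  = sym (trans (+-identityʳ _) (*-identityˡ 1ℚ))
  ∏-binomial {k = suc k} f p (x ∷ xs) = begin
    (f x - p) * ∏ (λ x → f x - p) xs        ≡⟨ cong ((f x - p) *_) (∏-binomial f p xs) ⟩
    (f x - p) * T                           ≡⟨ solve 3 (λ a q t → (a :- q) :* t := (:- q) :* t :+ a :* t) refl (f x) p T ⟩
    (- p) * T + f x * T                     ≡⟨ cong₂ _+_ (∑-*ˡ (allVecs k) (- p) _) (∑-*ˡ (allVecs k) (f x) _) ⟩
    ∑[ allVecs k ] (λ c → - p * F c) + ∑[ allVecs k ] (λ c → f x * F c)
      ≡⟨ cong₂ _+_ (∑-cong (allVecs k) dropped) (∑-cong (allVecs k) kept) ⟩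
    ∑[ allVecs k ] (G ∘ (false ∷_)) + ∑[ allVecs k ] (G ∘ (true ∷_)) ≡⟨ ∑-allVecs-suc G ⟨
    ∑[ allVecs (suc k) ] G                  ∎
    where
    open ≡-Reasoning
    F : Vec Bool k → ℚ
    F c = powℚ (- p) (#false c) * ∏-selected f c xs
    T = ∑[ allVecs k ] F
    G : Vec Bool (suc k) → ℚ
    G c = powℚ (- p) (#false c) * ∏-selected f c (x ∷ xs)
    dropped : ∀ c → - p * F c ≡ G (false ∷ c)
    dropped c = solve 3 (λ q a b → q :* (a :* b) := (q :* a) :* (con 1ℚ :* b)) refl
                        (- p) (powℚ (- p) (#false c)) (∏-selected f c xs)
    kept : ∀ c → f x * F c ≡ G (true ∷ c)
    kept c = solve 3 (λ y a b → y :* (a :* b) := a :* (y :* b)) refl (f x) (powℚ (- p) (#false c)) (∏-selected f c xs)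

  indicator-∧ : ∀ a b → indicator (a ∧ b) ≡ indicator a * indicator b
  indicator-∧ false b = sym (*-zeroˡ (indicator b))
  indicator-∧ true  b = sym (*-identityˡ (indicator b))

  kernelIndicator : ∀ {m n} → Matrix m n → F2^ n → ℚ
  kernelIndicator M u = indicator (inKernel M u)

  ∏-selected-orthogonal : ∀ {n k} (S : Vec (F2^ n) k) (c : Vec Bool k) (r : F2^ n) →
                          ∏-selected (λ u → indicator (not (dot r u))) c S ≡ indicator (orthogonal S c r)
  ∏-selected-orthogonal []       []          r = refl
  ∏-selected-orthogonal (u ∷ S) (false ∷ c) r = trans (*-identityˡ _) (∏-selected-orthogonal S c r)
  ∏-selected-orthogonal (u ∷ S) (true ∷ c)  r =
    trans (cong (indicator (not (dot r u)) *_) (∏-selected-orthogonal S c r))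
          (sym (indicator-∧ (not (dot r u)) (orthogonal S c r)))

  ∏-selected-kernelIndicator : ∀ {m n k} (M : Matrix m n) (S : Vec (F2^ n) k) (c : Vec Bool k) →
                               ∏-selected (kernelIndicator M) c S ≡ ∏ (λ row → indicator (orthogonal S c row)) M
  ∏-selected-kernelIndicator []        S c = ∏-selected-one c S
  ∏-selected-kernelIndicator (row ∷ M) S c = begin
    ∏-selected (kernelIndicator (row ∷ M)) c S
      ≡⟨ ∏-selected-cong c S (λ u → indicator-∧ (not (dot row u)) (inKernel M u)) ⟩
    ∏-selected (λ u → indicator (not (dot row u)) * kernelIndicator M u) c S
      ≡⟨ ∏-selected-* _ _ c S ⟩
    ∏-selected (λ u → indicator (not (dot row u))) c S * ∏-selected (kernelIndicator M) c S
      ≡⟨ cong₂ _*_ (∏-selected-orthogonal S c row) (∏-selected-kernelIndicator M S c) ⟩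
    indicator (orthogonal S c row) * ∏ (λ row → indicator (orthogonal S c row)) M ∎
    where open ≡-Reasoning

  expect-cong : ∀ m n {f g : Matrix m n → ℚ} → (∀ M → f M ≡ g M) → expect m n f ≡ expect m n g
  expect-cong m n f≗g = cong (powℚ ½ (m ℕ.* n) *_) (∑-cong (allMatrices m n) f≗g)

  expect-∑ : ∀ m n {A : Set} (ys : List A) (h : Matrix m n → A → ℚ) →
             expect m n (λ M → ∑[ ys ] (h M)) ≡ ∑[ ys ] (λ y → expect m n (λ M → h M y))
  expect-∑ m n ys h = trans (cong (powℚ ½ (m ℕ.* n) *_) (∑-swap (allMatrices m n) ys h))
                            (∑-*ˡ ys (powℚ ½ (m ℕ.* n)) _)

  expect-*ˡ : ∀ m n (a : ℚ) (f : Matrix m n → ℚ) → expect m n (λ M → a * f M) ≡ a * expect m n f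
  expect-*ˡ m n a f = trans (cong (powℚ ½ (m ℕ.* n) *_) (sym (∑-*ˡ (allMatrices m n) a f)))
    (solve 3 (λ B a s → B :* (a :* s) := a :* (B :* s)) refl (powℚ ½ (m ℕ.* n)) a _)

  -- (z / 2ⁿ)ᵐ: the probability that m independent uniform rows all lie in a set of size z.
  cellProbability : ℕ → ℕ → ℕ → ℚ
  cellProbability m n z = powℚ ½ (m ℕ.* n) * powℚ (toℚ z) m

  expect-∏-selected : ∀ m n {k} (S : Vec (F2^ n) k) (c : Vec Bool k) →
                      expect m n (λ M → ∏-selected (kernelIndicator M) c S) ≡
                      cellProbability m n (annihilatorSize S c)
  expect-∏-selected m n S c = cong (powℚ ½ (m ℕ.* n) *_) (begin
    ∑[ allMatrices m n ] (λ M → ∏-selected (kernelIndicator M) c S)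
      ≡⟨ ∑-cong (allMatrices m n) (λ M → ∏-selected-kernelIndicator M S c) ⟩
    ∑[ allSeqs (allVecs n) m ] (∏ (indicator ∘ orthogonal S c))
      ≡⟨ powℚ-∑ (allVecs n) (indicator ∘ orthogonal S c) m ⟨
    powℚ (∑[ allVecs n ] (indicator ∘ orthogonal S c)) m
      ≡⟨ cong (λ z → powℚ z m) (∑-indicator (orthogonal S c) (allVecs n)) ⟩
    powℚ (toℚ (annihilatorSize S c)) m ∎)
    where open ≡-Reasoning

  ^-distribʳ-* : ∀ a b m → (a ℕ.* b) ℕ.^ m ≡ a ℕ.^ m ℕ.* b ℕ.^ m
  ^-distribʳ-* a b zero    = refl
  ^-distribʳ-* a b (suc m) = trans (cong (a ℕ.* b ℕ.*_) (^-distribʳ-* a b m))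
                                   (interchange a b (a ℕ.^ m) (b ℕ.^ m))

  cellProbability≡p^ : ∀ m n z s → z ℕ.* 2 ℕ.^ s ≡ 2 ℕ.^ n → cellProbability m n z ≡ powℚ (pval m) s
  cellProbability≡p^ m n z s z2ˢ≡2ⁿ = begin
    powℚ ½ (m ℕ.* n) * powℚ (toℚ z) m   ≡⟨ *-comm (powℚ ½ (m ℕ.* n)) _ ⟩
    powℚ (toℚ z) m * powℚ ½ (m ℕ.* n)   ≡⟨ cong₂ (λ x y → x * powℚ ½ y) (powℚ-toℚ z m) (ℕ.*-comm m n) ⟩
    toℚ (z ℕ.^ m) * powℚ ½ (n ℕ.* m)    ≡⟨ ½^-scale-≡ (z ℕ.^ m) (s ℕ.* m) (n ℕ.* m) lifted ⟩
    powℚ ½ (s ℕ.* m)                    ≡⟨ cong (powℚ ½) (ℕ.*-comm s m) ⟩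
    powℚ ½ (m ℕ.* s)                    ≡⟨ powℚ-* ½ m s ⟩
    powℚ (pval m) s                     ∎
    where
    open ≡-Reasoning
    lifted : z ℕ.^ m ℕ.* 2 ℕ.^ (s ℕ.* m) ≡ 2 ℕ.^ (n ℕ.* m)
    lifted = trans (cong (z ℕ.^ m ℕ.*_) (sym (ℕ.^-*-assoc 2 s m)))
               (trans (sym (^-distribʳ-* z (2 ℕ.^ s) m))
                 (trans (cong (ℕ._^ m) z2ˢ≡2ⁿ) (ℕ.^-*-assoc 2 n m)))

  Xval≡∑ : ∀ {m n} i (M : Matrix m n) → toℚ (Xval i M) ≡ ∑[ Lset n i ] (kernelIndicator M)
  Xval≡∑ {n = n} i M = go (Lset n i)
    where
    go : (xs : List (F2^ n)) →
         toℚ (length (filter (λ x → inKernel M x Bool.≟ true) xs)) ≡ ∑[ xs ] (kernelIndicator M)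
    go []       = refl
    go (x ∷ xs) with inKernel M x
    ... | true  = trans (toℚ-suc (length (filter (λ x → inKernel M x Bool.≟ true) xs))) (cong (1ℚ +_) (go xs))
    ... | false = trans (go xs) (sym (+-identityˡ _))

  ∑-filter-cong : ∀ {A : Set} {P : A → Set} (P? : ∀ x → Dec (P x)) (xs : List A) {f g : A → ℚ} →
                  (∀ x → P x → f x ≡ g x) → ∑[ filter P? xs ] f ≡ ∑[ filter P? xs ] g
  ∑-filter-cong P? []       _   = refl
  ∑-filter-cong P? (x ∷ xs) f≗g with P? x
  ... | yes Px = cong₂ _+_ (f≗g x Px) (∑-filter-cong P? xs f≗g)
  ... | no  _  = ∑-filter-cong P? xs f≗g

  expect-kernelIndicator : ∀ m n (x : F2^ n) → x ≢ zeroV → expect m n (λ M → kernelIndicator M x) ≡ pval m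
  expect-kernelIndicator m n x x≢0 = begin
    expect m n (λ M → kernelIndicator M x)
      ≡⟨ expect-cong m n {λ M → kernelIndicator M x * 1ℚ} {λ M → kernelIndicator M x}
                     (λ M → *-identityʳ (kernelIndicator M x)) ⟨
    expect m n (λ M → ∏-selected (kernelIndicator M) (true ∷ []) (x ∷ []))
      ≡⟨ expect-∏-selected m n (x ∷ []) (true ∷ []) ⟩
    cellProbability m n (annihilatorSize (x ∷ []) (true ∷ []))
      ≡⟨ cellProbability≡p^ m n (annihilatorSize (x ∷ []) (true ∷ [])) 1 (Φ-singleton x x≢0) ⟩
    pval m * 1ℚ
      ≡⟨ *-identityʳ (pval m) ⟩
    pval m ∎
    where open ≡-Reasoning

  weight-zeroV : ∀ n → weight (zeroV {n}) ≡ 0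
  weight-zeroV zero    = refl
  weight-zeroV (suc n) = weight-zeroV n

  meanX≡∑ : ∀ m n i → 0 ℕ.< i → meanX m n i ≡ ∑[ Lset n i ] (λ _ → pval m)
  meanX≡∑ m n i 0<i = begin
    expect m n (λ M → toℚ (Xval i M))
      ≡⟨ expect-cong m n (Xval≡∑ i) ⟩
    expect m n (λ M → ∑[ Lset n i ] (kernelIndicator M))
      ≡⟨ expect-∑ m n (Lset n i) kernelIndicator ⟩
    ∑[ Lset n i ] (λ x → expect m n (λ M → kernelIndicator M x))
      ≡⟨ ∑-filter-cong (λ v → weight v ℕ.≟ i) (allVecs n)
           (λ x wx≡i → expect-kernelIndicator m n x (λ { refl → ℕ.<-irrefl (trans (sym (weight-zeroV n)) wx≡i) 0<i })) ⟩
    ∑[ Lset n i ] (λ _ → pval m) ∎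
    where open ≡-Reasoning

  sequenceMoment : ∀ m n {k} → Vec (F2^ n) k → ℚ
  sequenceMoment m n S = expect m n (λ M → ∏ (λ u → kernelIndicator M u - pval m) S)

  centralMoment≡∑ : ∀ m n i k → 0 ℕ.< i →
                    centralMoment m n i k ≡ ∑[ allSeqs (Lset n i) k ] (sequenceMoment m n)
  centralMoment≡∑ m n i k 0<i = trans (expect-cong m n expand)
    (expect-∑ m n (allSeqs (Lset n i) k) (λ M → ∏ (λ u → kernelIndicator M u - pval m)))
    where
    expand : ∀ M → powℚ (toℚ (Xval i M) - meanX m n i) k ≡
                   ∑[ allSeqs (Lset n i) k ] (∏ (λ u → kernelIndicator M u - pval m))
    expand M = trans
      (cong (λ z → powℚ z k)
        (trans (cong₂ _-_ (Xval≡∑ i M) (meanX≡∑ m n i 0<i)) (∑-- (Lset n i) (kernelIndicator M) (λ _ → pval m))))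
      (powℚ-∑ (Lset n i) (λ u → kernelIndicator M u - pval m) k)

  term : ∀ m n {k} → Vec (F2^ n) k → Vec Bool k → ℚ
  term m n S c = powℚ (- pval m) (#false c) * cellProbability m n (annihilatorSize S c)

  sequenceMoment≡∑term : ∀ m n {k} (S : Vec (F2^ n) k) → sequenceMoment m n S ≡ ∑[ allVecs k ] (term m n S)
  sequenceMoment≡∑term m n {k} S = begin
    sequenceMoment m n S
      ≡⟨ expect-cong m n (λ M → ∏-binomial (kernelIndicator M) (pval m) S) ⟩
    expect m n (λ M → ∑[ allVecs k ] (λ c → powℚ (- pval m) (#false c) * ∏-selected (kernelIndicator M) c S))
      ≡⟨ expect-∑ m n (allVecs k) _ ⟩
    ∑[ allVecs k ] (λ c → expect m n (λ M → powℚ (- pval m) (#false c) * ∏-selected (kernelIndicator M) c S))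
      ≡⟨ ∑-cong (allVecs k) (λ c → trans (expect-*ˡ m n (powℚ (- pval m) (#false c)) (λ M → ∏-selected (kernelIndicator M) c S))
                                         (cong (powℚ (- pval m) (#false c) *_) (expect-∏-selected m n S c))) ⟩
    ∑[ allVecs k ] (term m n S) ∎
    where open ≡-Reasoning

  ∑-allVecs-pairs : ∀ k (j : Fin k) (f : Vec Bool k → ℚ) →
                    (∀ c → lookup c j ≡ false → f c + f (c [ j ]≔ true) ≡ 0ℚ) → ∑[ allVecs k ] f ≡ 0ℚ
  ∑-allVecs-pairs (suc k) zero f cancels = begin
    ∑[ allVecs (suc k) ] f                                          ≡⟨ ∑-allVecs-suc f ⟩
    ∑[ allVecs k ] (f ∘ (false ∷_)) + ∑[ allVecs k ] (f ∘ (true ∷_)) ≡⟨ ∑-+ (allVecs k) _ _ ⟨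
    ∑[ allVecs k ] (λ c → f (false ∷ c) + f (true ∷ c))             ≡⟨ ∑-cong (allVecs k) (λ c → cancels (false ∷ c) refl) ⟩
    ∑[ allVecs k ] (λ _ → 0ℚ)                                       ≡⟨ ∑-zero (allVecs k) ⟩
    0ℚ                                                              ∎
    where open ≡-Reasoning
  ∑-allVecs-pairs (suc k) (suc j) f cancels = trans (∑-allVecs-suc f)
    (cong₂ _+_ (∑-allVecs-pairs k j (f ∘ (false ∷_)) (λ c → cancels (false ∷ c)))
               (∑-allVecs-pairs k j (f ∘ (true ∷_)) (λ c → cancels (true ∷ c))))

  #false-[]≔true : ∀ {k} (c : Vec Bool k) (j : Fin k) → lookup c j ≡ false →
                   #false c ≡ suc (#false (c [ j ]≔ true))
  #false-[]≔true (false ∷ c) zero    _    = refl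
  #false-[]≔true (false ∷ c) (suc j) cⱼ≡f = cong suc (#false-[]≔true c j cⱼ≡f)
  #false-[]≔true (true ∷ c)  (suc j) cⱼ≡f = #false-[]≔true c j cⱼ≡f

  -- Toggling a coloop halves the annihilator, which exactly cancels the extra factor −p.
  sequenceMoment-coloop : ∀ m n {k} (S : Vec (F2^ n) k) → noColoops S ≡ false → sequenceMoment m n S ≡ 0ℚ
  sequenceMoment-coloop m n {k} S coloop with coloop⇒separated S coloop
  ... | j , sep = trans (sequenceMoment≡∑term m n S) (∑-allVecs-pairs k j (term m n S) cancels)
    where
    cancels : ∀ c → lookup c j ≡ false → term m n S c + term m n S (c [ j ]≔ true) ≡ 0ℚ
    cancels c cⱼ≡f = begin
      term m n S c + term m n S c′
        ≡⟨ cong₂ (λ a z → powℚ (- p) a * (B * powℚ (toℚ z) m) + term m n S c′)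
                 (#false-[]≔true c j cⱼ≡f) (coloop-halves S j sep c cⱼ≡f) ⟩
      (- p) * P * (B * powℚ (toℚ (2 ℕ.* z′)) m) + P * (B * Z′)
        ≡⟨ cong (λ x → (- p) * P * (B * x) + P * (B * Z′))
                (trans (cong (λ y → powℚ y m) (toℚ-homo-* 2 z′)) (powℚ-distrib-* (toℚ 2) (toℚ z′) m)) ⟩
      (- p) * P * (B * (T * Z′)) + P * (B * Z′)
        ≡⟨ solve 5 (λ p P B T Z → (:- p) :* P :* (B :* (T :* Z)) :+ P :* (B :* Z) := P :* B :* Z :* (con 1ℚ :- p :* T))
                 refl p P B T Z′ ⟩
      P * B * Z′ * (1ℚ - p * T)
        ≡⟨ cong (λ x → P * B * Z′ * (1ℚ - x)) (½^*2^≡1 m) ⟩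
      P * B * Z′ * (1ℚ - 1ℚ)
        ≡⟨ *-zeroʳ (P * B * Z′) ⟩
      0ℚ ∎
      where
      open ≡-Reasoning
      c′ = c [ j ]≔ true
      p  = pval m
      P  = powℚ (- p) (#false c′)
      B  = powℚ ½ (m ℕ.* n)
      z′ = annihilatorSize S c′
      Z′ = powℚ (toℚ z′) m
      T  = powℚ (toℚ 2) m

  isFull : ∀ {k} → Vec Bool k → Bool
  isFull []      = true
  isFull (b ∷ c) = b ∧ isFull c

  ∑-indicator-isFull : ∀ k → ∑[ allVecs k ] (indicator ∘ isFull) ≡ 1ℚ
  ∑-indicator-isFull zero    = refl
  ∑-indicator-isFull (suc k) = trans (∑-allVecs-suc {k} (indicator ∘ isFull))
    (trans (cong₂ _+_ (∑-zero (allVecs k)) (∑-indicator-isFull k)) (+-identityˡ 1ℚ))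

  full⊎missing : ∀ {k} (c : Vec Bool k) → c ≡ full k ⊎ ∃[ l ] lookup c l ≡ false
  full⊎missing []          = inj₁ refl
  full⊎missing (false ∷ c) = inj₂ (zero , refl)
  full⊎missing (true ∷ c) with full⊎missing c
  ... | inj₁ c≡full       = inj₁ (cong (true ∷_) c≡full)
  ... | inj₂ (l , cₗ≡f)   = inj₂ (suc l , cₗ≡f)

  isFull-full : ∀ k → isFull (full k) ≡ true
  isFull-full zero    = refl
  isFull-full (suc k) = isFull-full k

  isFull-missing : ∀ {k} (c : Vec Bool k) l → lookup c l ≡ false → isFull c ≡ false
  isFull-missing (false ∷ c) zero    _    = refl
  isFull-missing (false ∷ c) (suc l) _    = refl
  isFull-missing (true ∷ c)  (suc l) cₗ≡f = isFull-missing c l cₗ≡f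

  #false-full : ∀ k → #false (full k) ≡ 0
  #false-full zero    = refl
  #false-full (suc k) = #false-full k

  weight+#false : ∀ {k} (c : Vec Bool k) → weight c ℕ.+ #false c ≡ k
  weight+#false []          = refl
  weight+#false (false ∷ c) = trans (ℕ.+-suc _ _) (cong suc (weight+#false c))
  weight+#false (true ∷ c)  = cong suc (weight+#false c)

  powℚ-neg : ∀ x t → powℚ (- x) t ≡ powℚ x t ⊎ powℚ (- x) t ≡ - powℚ x t
  powℚ-neg x zero    = inj₁ refl
  powℚ-neg x (suc t) with powℚ-neg x t
  ... | inj₁ even = inj₂ (trans (cong (- x *_) even) (sym (neg-distribˡ-* x (powℚ x t))))
  ... | inj₂ odd  = inj₁ (trans (cong (- x *_) odd)
                                (solve 2 (λ x X → (:- x) :* (:- X) := x :* X) refl x (powℚ x t)))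

  ±-bounded : ∀ {x X Y} → x ≡ X ⊎ x ≡ - X → 0ℚ ≤ X → X ≤ Y → - Y ≤ x × x ≤ Y
  ±-bounded (inj₁ refl) 0≤X X≤Y = ≤-trans (neg-antimono-≤ X≤Y) (≤-trans (neg-antimono-≤ 0≤X) 0≤X) , X≤Y
  ±-bounded (inj₂ refl) 0≤X X≤Y = neg-antimono-≤ X≤Y , ≤-trans (neg-antimono-≤ 0≤X) (≤-trans 0≤X X≤Y)

  annihilatorSize-missing : ∀ {n k} (S : Vec (F2^ n) k) → noColoops S ≡ true → ∀ c l → lookup c l ≡ false →
                            annihilatorSize S c ℕ.≤ annihilatorSize S (full k) ℕ.* 2 ℕ.^ #false (c [ l ]≔ true)
  annihilatorSize-missing {k = k} S noColoop c l cₗ≡f =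
    ℕ.*-cancelʳ-≤ _ _ (2 ℕ.^ suc w) {{ℕ.m^n≢0 2 (suc w)}}
      (ℕ.≤-trans (annihilatorSize-nonFull S noColoop c l cₗ≡f) (ℕ.≤-reflexive (begin
        zfull ℕ.* 2 ℕ.^ k                       ≡⟨ cong (λ e → zfull ℕ.* 2 ℕ.^ e) k≡ ⟩
        zfull ℕ.* 2 ℕ.^ (suc w ℕ.+ f)           ≡⟨ cong (zfull ℕ.*_) (ℕ.^-distribˡ-+-* 2 (suc w) f) ⟩
        zfull ℕ.* (2 ℕ.^ suc w ℕ.* 2 ℕ.^ f)     ≡⟨ cong (zfull ℕ.*_) (ℕ.*-comm (2 ℕ.^ suc w) (2 ℕ.^ f)) ⟩
        zfull ℕ.* (2 ℕ.^ f ℕ.* 2 ℕ.^ suc w)     ≡⟨ ℕ.*-assoc zfull (2 ℕ.^ f) _ ⟨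
        zfull ℕ.* 2 ℕ.^ f ℕ.* 2 ℕ.^ suc w       ∎)))
    where
    open ≡-Reasoning
    w = weight c
    f = #false (c [ l ]≔ true)
    zfull = annihilatorSize S (full k)
    k≡ : k ≡ suc w ℕ.+ f
    k≡ = trans (sym (weight+#false c)) (trans (cong (w ℕ.+_) (#false-[]≔true c l cₗ≡f)) (ℕ.+-suc w f))

  fullCell : ∀ m n {k} → Vec (F2^ n) k → ℚ
  fullCell m n {k} S = cellProbability m n (annihilatorSize S (full k))

  cellProbability-nonNeg : ∀ m n z → 0ℚ ≤ cellProbability m n z
  cellProbability-nonNeg m n z = *-nonNeg (½^-nonNeg (m ℕ.* n)) (powℚ-nonNeg _ m (toℚ-nonNeg z))

  term-missing-≤ : ∀ m n {k} (S : Vec (F2^ n) k) → noColoops S ≡ true → ∀ c l → lookup c l ≡ false →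
                   powℚ (pval m) (#false c) * cellProbability m n (annihilatorSize S c) ≤ pval m * fullCell m n S
  term-missing-≤ m n {k} S noColoop c l cₗ≡f = begin
    powℚ p (#false c) * (B * powℚ (toℚ z) m)
      ≡⟨ cong (λ t → powℚ p t * (B * powℚ (toℚ z) m)) (#false-[]≔true c l cₗ≡f) ⟩
    p * powℚ p f * (B * powℚ (toℚ z) m)
      ≡⟨ cong₂ (λ a b → p * a * (B * b)) (trans (sym (powℚ-* ½ m f)) (cong (powℚ ½) (ℕ.*-comm m f))) (powℚ-toℚ z m) ⟩
    p * powℚ ½ (f ℕ.* m) * (B * toℚ (z ℕ.^ m))
      ≡⟨ solve 4 (λ p H B Z → p :* H :* (B :* Z) := p :* (B :* (Z :* H))) refl p (powℚ ½ (f ℕ.* m)) B (toℚ (z ℕ.^ m)) ⟩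
    p * (B * (toℚ (z ℕ.^ m) * powℚ ½ (f ℕ.* m)))
      ≤⟨ *-monoˡ-≤-nonNeg p {{ℚ.nonNegative (½^-nonNeg m)}}
           (*-monoˡ-≤-nonNeg B {{ℚ.nonNegative (½^-nonNeg (m ℕ.* n))}} (½^-scale-≤ (z ℕ.^ m) (zfull ℕ.^ m) 0 (f ℕ.* m) zᵐ≤)) ⟩
    p * (B * (toℚ (zfull ℕ.^ m) * 1ℚ))
      ≡⟨ cong (λ t → p * (B * t)) (trans (*-identityʳ _) (sym (powℚ-toℚ zfull m))) ⟩
    p * fullCell m n S ∎
    where
    open ≤-Reasoning
    p = pval m
    B = powℚ ½ (m ℕ.* n)
    z = annihilatorSize S c
    zfull = annihilatorSize S (full k)
    f = #false (c [ l ]≔ true)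
    zᵐ≤ : z ℕ.^ m ℕ.* 2 ℕ.^ 0 ℕ.≤ zfull ℕ.^ m ℕ.* 2 ℕ.^ (f ℕ.* m)
    zᵐ≤ = ℕ.≤-trans (ℕ.≤-reflexive (ℕ.*-identityʳ _))
            (ℕ.≤-trans (ℕ.^-monoˡ-≤ m (annihilatorSize-missing S noColoop c l cₗ≡f))
              (ℕ.≤-reflexive (trans (^-distribʳ-* zfull (2 ℕ.^ f) m) (cong (zfull ℕ.^ m ℕ.*_) (ℕ.^-*-assoc 2 f m)))))

  -- The full mask contributes fullCell exactly; every other mask contributes at most p · fullCell.
  deviation : ∀ m n {k} → Vec (F2^ n) k → Vec Bool k → ℚ
  deviation m n S c = term m n S c - indicator (isFull c) * fullCell m n S

  deviation-bounded : ∀ m n {k} (S : Vec (F2^ n) k) → noColoops S ≡ true → ∀ c →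
                      - (pval m * fullCell m n S) ≤ deviation m n S c × deviation m n S c ≤ pval m * fullCell m n S
  deviation-bounded m n {k} S noColoop c with full⊎missing c
  ... | inj₁ refl = subst (λ v → - (pval m * fullCell m n S) ≤ v × v ≤ pval m * fullCell m n S) (sym deviation≡0)
                          (±-bounded {x = 0ℚ} (inj₁ refl) ≤-refl 0≤pW)
    where
    0≤pW : 0ℚ ≤ pval m * fullCell m n S
    0≤pW = *-nonNeg (½^-nonNeg m) (cellProbability-nonNeg m n (annihilatorSize S (full k)))
    deviation≡0 : deviation m n S (full k) ≡ 0ℚ
    deviation≡0 rewrite #false-full k | isFull-full k =
      solve 1 (λ w → con 1ℚ :* w :- con 1ℚ :* w := con 0ℚ) refl (fullCell m n S)
  ... | inj₂ (l , cₗ≡f) = subst (λ v → - (pval m * fullCell m n S) ≤ v × v ≤ pval m * fullCell m n S)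
                                (sym deviation≡term)
                                (±-bounded sign 0≤X (term-missing-≤ m n S noColoop c l cₗ≡f))
    where
    deviation≡term : deviation m n S c ≡ term m n S c
    deviation≡term rewrite isFull-missing c l cₗ≡f =
      solve 2 (λ a w → a :- con 0ℚ :* w := a) refl (term m n S c) (fullCell m n S)
    R = cellProbability m n (annihilatorSize S c)
    0≤X : 0ℚ ≤ powℚ (pval m) (#false c) * R
    0≤X = *-nonNeg (powℚ-nonNeg _ (#false c) (½^-nonNeg m)) (cellProbability-nonNeg m n (annihilatorSize S c))
    sign : term m n S c ≡ powℚ (pval m) (#false c) * R ⊎ term m n S c ≡ - (powℚ (pval m) (#false c) * R)
    sign with powℚ-neg (pval m) (#false c)
    ... | inj₁ even = inj₁ (cong (_* R) even)
    ... | inj₂ odd  = inj₂ (trans (cong (_* R) odd) (sym (neg-distribˡ-* (powℚ (pval m) (#false c)) R)))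

  2ᵏp≤½ : ∀ m k → 0 ℕ.< m → k ℕ.≤ m ℕ.∸ 1 → toℚ (2 ℕ.^ k) * pval m ≤ ½
  2ᵏp≤½ (suc m) k _ k≤m = ½^-scale-≤ (2 ℕ.^ k) 1 1 (suc m) (begin
    2 ℕ.^ k ℕ.* 2    ≡⟨ ℕ.*-comm (2 ℕ.^ k) 2 ⟩
    2 ℕ.^ suc k      ≤⟨ ℕ.^-monoʳ-≤ 2 (ℕ.s≤s k≤m) ⟩
    2 ℕ.^ suc m      ≡⟨ ℕ.*-identityˡ _ ⟨
    1 ℕ.* 2 ℕ.^ suc m ∎)
    where open ℕ.≤-Reasoning

  sequenceMoment≡fullCell+∑deviation : ∀ m n {k} (S : Vec (F2^ n) k) →
    sequenceMoment m n S ≡ fullCell m n S + ∑[ allVecs k ] (deviation m n S)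
  sequenceMoment≡fullCell+∑deviation m n {k} S = begin
    sequenceMoment m n S
      ≡⟨ sequenceMoment≡∑term m n S ⟩
    ∑[ allVecs k ] (term m n S)
      ≡⟨ ∑-cong (allVecs k) (λ c → solve 2 (λ a b → a := b :+ (a :- b)) refl (term m n S c) (indicator (isFull c) * W)) ⟩
    ∑[ allVecs k ] (λ c → indicator (isFull c) * W + deviation m n S c)
      ≡⟨ ∑-+ (allVecs k) _ (deviation m n S) ⟩
    ∑[ allVecs k ] (λ c → indicator (isFull c) * W) + ∑[ allVecs k ] (deviation m n S)
      ≡⟨ cong (_+ ∑[ allVecs k ] (deviation m n S))
              (trans (sym (∑-*ʳ (allVecs k) W (indicator ∘ isFull)))
                     (trans (cong (_* W) (∑-indicator-isFull k)) (*-identityˡ W))) ⟩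
    W + ∑[ allVecs k ] (deviation m n S) ∎
    where
    open ≡-Reasoning
    W = fullCell m n S

  ∑deviation-bounded : ∀ m n {k} (S : Vec (F2^ n) k) → noColoops S ≡ true → 0 ℕ.< m → k ℕ.≤ m ℕ.∸ 1 →
    - (½ * fullCell m n S) ≤ ∑[ allVecs k ] (deviation m n S) × ∑[ allVecs k ] (deviation m n S) ≤ ½ * fullCell m n S
  ∑deviation-bounded m n {k} S noColoop 0<m k≤m-1 =
    ≤-trans (neg-antimono-≤ K≤½W) (≤-trans (≤-reflexive -K≡∑) (∑-mono-≤ (allVecs k) (proj₁ ∘ bounded))) ,
    ≤-trans (∑-mono-≤ (allVecs k) (proj₂ ∘ bounded)) (≤-trans (≤-reflexive (∑-const-allVecs k _)) K≤½W)
    where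
    W = fullCell m n S
    K = toℚ (2 ℕ.^ k) * (pval m * W)
    bounded = deviation-bounded m n S noColoop
    K≤½W : K ≤ ½ * W
    K≤½W = ≤-trans (≤-reflexive (sym (*-assoc (toℚ (2 ℕ.^ k)) (pval m) W)))
             (*-monoʳ-≤-nonNeg W {{ℚ.nonNegative (cellProbability-nonNeg m n (annihilatorSize S (full k)))}} (2ᵏp≤½ m k 0<m k≤m-1))
    -K≡∑ : - K ≡ ∑[ allVecs k ] (λ _ → - (pval m * W))
    -K≡∑ = trans (neg-distribʳ-* (toℚ (2 ℕ.^ k)) (pval m * W)) (sym (∑-const-allVecs k _))

  sequenceMoment-coloopFree : ∀ m n {k} (S : Vec (F2^ n) k) → noColoops S ≡ true → 0 ℕ.< m → k ℕ.≤ m ℕ.∸ 1 →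
    ½ * fullCell m n S ≤ sequenceMoment m n S × sequenceMoment m n S ≤ toℚ 2 * fullCell m n S
  sequenceMoment-coloopFree m n {k} S noColoop 0<m k≤m-1 = lower , upper
    where
    open ≤-Reasoning
    W = fullCell m n S
    D = ∑[ allVecs k ] (deviation m n S)
    bounds = ∑deviation-bounded m n S noColoop 0<m k≤m-1
    0≤½W : 0ℚ ≤ ½ * W
    0≤½W = *-nonNeg ½-nonNeg (cellProbability-nonNeg m n (annihilatorSize S (full k)))
    lower : ½ * W ≤ sequenceMoment m n S
    lower = begin
      ½ * W           ≡⟨ solve 1 (λ w → con ½ :* w := w :+ (:- (con ½ :* w))) refl W ⟩
      W + - (½ * W)   ≤⟨ +-monoʳ-≤ W (proj₁ bounds) ⟩
      W + D           ≡⟨ sequenceMoment≡fullCell+∑deviation m n S ⟨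
      sequenceMoment m n S ∎
    upper : sequenceMoment m n S ≤ toℚ 2 * W
    upper = begin
      sequenceMoment m n S ≡⟨ sequenceMoment≡fullCell+∑deviation m n S ⟩
      W + D                ≤⟨ +-monoʳ-≤ W (proj₂ bounds) ⟩
      W + ½ * W            ≡⟨ +-identityʳ (W + ½ * W) ⟨
      W + ½ * W + 0ℚ       ≤⟨ +-monoʳ-≤ (W + ½ * W) 0≤½W ⟩
      W + ½ * W + ½ * W    ≡⟨ solve 1 (λ w → w :+ con ½ :* w :+ con ½ :* w := con (toℚ 2) :* w) refl W ⟩
      toℚ 2 * W            ∎

  fullCell≡p^rank : ∀ m n {k} (S : Vec (F2^ n) k) → fullCell m n S ≡ powℚ (pval m) (rank S)
  fullCell≡p^rank m n {k} S = cellProbability≡p^ m n (annihilatorSize S (full k)) (rank S) (rank-formula S)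

  contribution : ∀ m {n k} → Vec (F2^ n) k → ℚ
  contribution m S = if noColoops S then powℚ (pval m) (rank S) else 0ℚ

  sequenceMoment-bounds : ∀ m n {k} → 0 ℕ.< m → k ℕ.≤ m ℕ.∸ 1 → (S : Vec (F2^ n) k) →
                          ½ * contribution m S ≤ sequenceMoment m n S × sequenceMoment m n S ≤ toℚ 2 * contribution m S
  sequenceMoment-bounds m n 0<m k≤m-1 S with noColoops S in noColoop
  ... | true  = subst (λ w → ½ * w ≤ sequenceMoment m n S × sequenceMoment m n S ≤ toℚ 2 * w)
                      (fullCell≡p^rank m n S) (sequenceMoment-coloopFree m n S noColoop 0<m k≤m-1)
  ... | false = ≤-reflexive (trans (*-zeroʳ ½) (sym vanishes)) ,
                ≤-reflexive (trans vanishes (sym (*-zeroʳ (toℚ 2))))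
    where vanishes = sequenceMoment-coloop m n S noColoop


open import Data.Nat as ℕ using (ℕ)
open import Data.Nat.Divisibility using (_∣_)
open import Data.Rational as ℚ using (ℚ)
open import Data.Integer using (+_)
open import Data.Product using (_×_)
open import Relation.Binary.PropositionalEquality using (subst; sym)
open Moments using (contribution; sequenceMoment; centralMoment≡∑; sequenceMoment-bounds; ∑-sandwich)

proposition3p1 : (n i m k : ℕ) →
    0 ℕ.< i → 2 ℕ.* i ℕ.< n → 2 ∣ i →
    0 ℕ.< m → belowEntropy m n i →
    k ℕ.≤ m ℕ.∸ 1 →
    ((+ 1 ℚ./ 2) ℚ.* coloopFreeSum m n i k ℚ.≤ centralMoment m n i k)
      × (centralMoment m n i k ℚ.≤ (+ 2 ℚ./ 1) ℚ.* coloopFreeSum m n i k)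
proposition3p1 n i m k 0<i _ _ 0<m _ k≤m-1 =
  subst (λ μ → ½ ℚ.* coloopFreeSum m n i k ℚ.≤ μ × μ ℚ.≤ toℚ 2 ℚ.* coloopFreeSum m n i k)
        (sym (centralMoment≡∑ m n i k 0<i))
        (∑-sandwich (allSeqs (Lset n i) k) {½} {toℚ 2} {contribution m} {sequenceMoment m n}
                    (sequenceMoment-bounds m n 0<m k≤m-1))
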